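{- For every $n\ge 3$, the expected number of key comparisons performed in the first partitioning step of Algorithm S (Sedgewick's dual-pivot Quicksort) on an array $A[1..n]$ containing a uniformly random permutation of $\{1,\dots,n\}$ equals $$\tfrac{16}{9}(n+1)-3-\tfrac{2}{3}\cdot\tfrac{1}{n(n-1)}.$$
   Context: Algorithm S is the recursive procedure $S(A,\mathit{left},\mathit{right})$ on an array $A$: If $\mathit{right}-\mathit{left}\ge1$: set $i\gets\mathit{left}$, $i_1\gets\mathit{left}$, $j\gets\mathit{right}$, $j_1\gets\mathit{right}$, $p\gets A[\mathit{left}]$, $q\gets A[\mathit{right}]$; if $p>q$ (key comparison) exchange the values of the variables $p$ and $q$. Then repeat forever: { $i\gets i+1$; while $A[i]\le q$ (key comparison) do { if $i\ge j$, exit the outer loop; if $A[i]<p$ (key comparison) then $A[i_1]\gets A[i]$, $i_1\gets i_1+1$, $A[i]\gets A[i_1]$; $i\gets i+1$ }; $j\gets j-1$; while $A[j]\ge p$ (key comparison) do { if $A[j]>q$ (key comparison) then $A[j_1]\gets A[j]$, $j_1\gets j_1-1$, $A[j]\gets A[j_1]$; if $i\ge j$, exit the outer loop; $j\gets j-1$ }; $A[i_1]\gets A[j]$; $A[j_1]\gets A[i]$; $i_1\gets i_1+1$; $j_1\gets j_1-1$; $A[i]\gets A[i_1]$; $A[j]\gets A[j_1]$ }. After exiting the outer loop: $A[i_1]\gets p$; $A[j_1]\gets q$; call $S(A,\mathit{left},i_1-1)$, $S(A,i_1+1,j_1-1)$, $S(A,j_1+1,\mathit{right})$. The first partitioning step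 is the execution of the top-level call $S(A,1,n)$ excluding the three recursive calls. Key comparisons are evaluations of the comparisons marked "key comparison"; index comparisons are not counted. -}

module Defs where

open import Data.Bool using (Bool; true; false; if_then_else_)
open import Data.Nat using (ℕ; zero; suc; _+_; _*_; _∸_; _≤_; _!; _≤ᵇ_; _<ᵇ_; _≡ᵇ_; NonZero; s≤s; z≤n)
open import Data.Nat.Properties using (_!≢0)
open import Data.List using (List; []; _∷_; concatMap; map; length)
open import Data.Nat.ListAction using (sum)
open import Data.Integer using (+_)
open import Data.Rational using (ℚ; _/_)

-- Arrays are modelled as total functions ℕ → ℕ (1-indexed; positions
-- outside 1..n are never read by Algorithm S).

Array : Set
Array = ℕ → ℕ

update : Array → ℕ → ℕ → Array
update A k v m = if m ≡ᵇ k then v else A m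

-- The array A[1..n] holding the list xs (A[k] = k-th element).
fromList : List ℕ → Array
fromList []       _             = 0
fromList (x ∷ xs) zero          = 0
fromList (x ∷ xs) (suc zero)    = x
fromList (x ∷ xs) (suc (suc k)) = fromList xs (suc k)

record St : Set where
  constructor st
  field
    A  : Array
    i  : ℕ
    i₁ : ℕ
    j  : ℕ
    j₁ : ℕ
    p  : ℕ
    q  : ℕ
    cmp : ℕ

-- Control points:  atI  = about to evaluate the test  A[i] ≤ q
--                  atJ  = about to evaluate the test  A[j] ≥ p
data Pc : Set where
  atI atJ : Pc

-- Execution of the loops, with fuel (each transition consumes one unit;
-- the fuel supplied below, 4n+4, is more than the at most ~2n
-- transitions performed).  Returns the final comparison count.
run : ℕ → Pc → St → ℕ
run zero    _   s = St.cmp s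
run (suc f) atI (st A i i₁ j j₁ p q c) =
  if A i ≤ᵇ q
  then (if j ≤ᵇ i                     -- index check i ≥ j : exit outer loop
        then suc c
        else
          (if A i <ᵇ p
           then (let A₁ = update A i₁ (A i)
                     i₁′ = suc i₁
                     A₂ = update A₁ i (A₁ i₁′)
                 in run f atI (st A₂ (suc i) i₁′ j j₁ p q (suc (suc c))))
           else run f atI (st A (suc i) i₁ j j₁ p q (suc (suc c)))))
  else run f atJ (st A i i₁ (j ∸ 1) j₁ p q (suc c))
run (suc f) atJ (st A i i₁ j j₁ p q c) =
  if p ≤ᵇ A j
  then (let
            Aᵤ  = update A j₁ (A j)
            j₁′ = if q <ᵇ A j then j₁ ∸ 1 else j₁
            A′  = if q <ᵇ A j then update Aᵤ j (Aᵤ j₁′) else A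
            c′  = suc (suc c)
        in if j ≤ᵇ i                  -- index check i ≥ j : exit outer loop
           then c′
           else run f atJ (st A′ i i₁ (j ∸ 1) j₁′ p q c′))
  else (let A₁ = update A i₁ (A j)
            A₂ = update A₁ j₁ (A₁ i)
            i₁′ = suc i₁
            j₁′ = j₁ ∸ 1
            A₃ = update A₂ i (A₂ i₁′)
            A₄ = update A₃ j (A₃ j₁′)
        in run f atI (st A₄ (suc i) i₁′ j j₁′ p q (suc c)))

-- Number of key comparisons in the first partitioning step of Algorithm S,
-- i.e. the top-level call S(A,1,n) without its recursive calls, on the
-- array A[1..n] = xs  (n = length xs).
firstPartitionComparisons : List ℕ → ℕ
firstPartitionComparisons xs with length xs
... | n = if 1 ≤ᵇ (n ∸ 1)            -- right − left ≥ 1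
          then (let A  = fromList xs
                    p₀ = A 1
                    q₀ = A n
                    p  = if q₀ <ᵇ p₀ then q₀ else p₀
                    q  = if q₀ <ᵇ p₀ then p₀ else q₀
                in run (4 * n + 4) atI (st A 2 1 n n p q 1))
          else 0

insertions : ℕ → List ℕ → List (List ℕ)
insertions x []       = (x ∷ []) ∷ []
insertions x (y ∷ ys) = (x ∷ y ∷ ys) ∷ map (y ∷_) (insertions x ys)

permutationsOf : List ℕ → List (List ℕ)
permutationsOf []       = [] ∷ []
permutationsOf (x ∷ xs) = concatMap (insertions x) (permutationsOf xs)

oneTo : ℕ → List ℕ
oneTo zero    = []
oneTo (suc n) = 1 ∷ map suc (oneTo n)

allPerms : ℕ → List (List ℕ)
allPerms n = permutationsOf (oneTo n)

expectedComparisons : ℕ → ℚ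
expectedComparisons n =
  (+ sum (map firstPartitionComparisons (allPerms n)) / (n !)) {{n !≢0}}

nonZero-n[n-1] : ∀ n → 3 ≤ n → NonZero (n * (n ∸ 1))
nonZero-n[n-1] (suc (suc (suc m))) _ = _
nonZero-n[n-1] (suc zero) (s≤s ())
nonZero-n[n-1] (suc (suc zero)) (s≤s (s≤s ()))

module Submission where

-- (1) Loops, FirstStep: apart from the pivot comparison, the loops perform a
--     number of comparisons that only depends on the classes (small < p ≤
--     medium ≤ q < large) of the inner elements: i reads from the left, j
--     from the right, every element costs two comparisons except those that
--     hand the scan over to the other pointer, which cost one.
-- (2) Sums, Counting: summed over the N! orders of the N = n − 2 inner
--     elements, this cost is a function permCost of the numbers s, m, l of
--     small, medium and large ones, by a recursion on the first element read.
-- (3) ClosedForm: (s + l) · permCost = N! ((2N+1)(s+l) − 2sl), by induction.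
-- (4) RangeSums, PivotPairs, Summation: grouping the permutations by their
--     end values, and the pairs of end values by t = s + l, sums this to the
--     total over all n! permutations.
-- (5) Rationals: dividing by n! gives the stated rational number.

module Prelim where

  open import Defs using (update)
  open import Data.Bool using (Bool; true; false; T; if_then_else_)
  open import Data.Unit using (tt)
  open import Data.Empty using (⊥-elim)
  open import Data.Nat using (_≤_; _<_; _≤ᵇ_; _<ᵇ_; _≡ᵇ_)
  open import Data.Nat.Properties using (≤⇒≤ᵇ; ≤ᵇ⇒≤; <⇒<ᵇ; <ᵇ⇒<; ≡⇒≡ᵇ; ≡ᵇ⇒≡; <⇒≱)
  open import Data.Bool.Properties using (T-≡)
  open import Function.Bundles using (Equivalence)
  open import Relation.Nullary using (¬_)
  open import Relation.Binary.PropositionalEquality using (_≡_; _≢_; refl)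

  ¬T⇒false : ∀ {b} → ¬ T b → b ≡ false
  ¬T⇒false {false} _   = refl
  ¬T⇒false {true}  ¬tt = ⊥-elim (¬tt tt)

  ≤ᵇ-true : ∀ {m n} → m ≤ n → (m ≤ᵇ n) ≡ true
  ≤ᵇ-true m≤n = Equivalence.to T-≡ (≤⇒≤ᵇ m≤n)

  ≤ᵇ-false : ∀ {m n} → n < m → (m ≤ᵇ n) ≡ false
  ≤ᵇ-false {m} {n} n<m = ¬T⇒false (λ t → <⇒≱ n<m (≤ᵇ⇒≤ m n t))

  <ᵇ-true : ∀ {m n} → m < n → (m <ᵇ n) ≡ true
  <ᵇ-true m<n = Equivalence.to T-≡ (<⇒<ᵇ m<n)

  <ᵇ-false : ∀ {m n} → n ≤ m → (m <ᵇ n) ≡ false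
  <ᵇ-false {m} {n} n≤m = ¬T⇒false (λ t → <⇒≱ (<ᵇ⇒< m n t) n≤m)

  ≡ᵇ-refl : ∀ m → (m ≡ᵇ m) ≡ true
  ≡ᵇ-refl m = Equivalence.to T-≡ (≡⇒≡ᵇ m m refl)

  ≡ᵇ-false : ∀ {m n} → m ≢ n → (m ≡ᵇ n) ≡ false
  ≡ᵇ-false {m} {n} m≢n = ¬T⇒false (λ t → m≢n (≡ᵇ⇒≡ m n t))

  update-same : ∀ A k v → update A k v k ≡ v
  update-same A k v rewrite ≡ᵇ-refl k = refl

  update-other : ∀ A k v m → m ≢ k → update A k v m ≡ A m
  update-other A k v m m≢k rewrite ≡ᵇ-false m≢k = refl

  if-cong : ∀ {A : Set} {b b′ : Bool} {x x′ y y′ : A} → b ≡ b′ → x ≡ x′ → y ≡ y′ →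
            (if b then x else y) ≡ (if b′ then x′ else y′)
  if-cong refl refl refl = refl

module Loops where

  open import Defs
  open Prelim
  open import Data.Bool using (true; false; if_then_else_)
  open import Data.Nat
  open import Data.Nat.Properties
  open import Data.Sum using (inj₁; inj₂)
  open import Relation.Nullary.Reflects using (ofⁿ)
  open import Relation.Binary.PropositionalEquality hiding (J)

  -- The comparison count of the partitioning loops, computed from the input
  -- alone.  The unread part of the array is the window  lo, …, lo+k−1;
  -- costI reads its leftmost element (pointer i active), costJ its rightmost
  -- one (pointer j active).  Small (< p) and medium elements keep i running,
  -- a large one (> q) hands over to j; symmetrically for j.  Each element
  -- costs two comparisons, except the one causing a hand-over, which costs
  -- one; the final test on an already classified element costs 1 resp. 2.
  module Scan (p q : ℕ) where
    mutual
      costI : (ℕ → ℕ) → ℕ → ℕ → ℕ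
      costI f lo zero    = 1
      costI f lo (suc k) = if f lo ≤ᵇ q then 2 + costI f (suc lo) k else 1 + costJ f (suc lo) k

      costJ : (ℕ → ℕ) → ℕ → ℕ → ℕ
      costJ f lo zero    = 2
      costJ f lo (suc k) = if p ≤ᵇ f (lo + k) then 2 + costJ f lo k else 1 + costI f lo k

    mutual
      costI-window : ∀ {f g} lo lo′ k → (∀ x → x < k → f (lo + x) ≡ g (lo′ + x)) →
                     costI f lo k ≡ costI g lo′ k
      costI-window lo lo′ zero    same = refl
      costI-window {f} {g} lo lo′ (suc k) same =
        if-cong (cong (_≤ᵇ q) first) (cong (2 +_) (costI-window (suc lo) (suc lo′) k same′))
                                     (cong (1 +_) (costJ-window (suc lo) (suc lo′) k same′))
        where
          first : f lo ≡ g lo′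
          first = subst₂ (λ u v → f u ≡ g v) (+-identityʳ lo) (+-identityʳ lo′) (same 0 z<s)
          same′ : ∀ x → x < k → f (suc lo + x) ≡ g (suc lo′ + x)
          same′ x x<k = subst₂ (λ u v → f u ≡ g v) (+-suc lo x) (+-suc lo′ x) (same (suc x) (s≤s x<k))

      costJ-window : ∀ {f g} lo lo′ k → (∀ x → x < k → f (lo + x) ≡ g (lo′ + x)) →
                     costJ f lo k ≡ costJ g lo′ k
      costJ-window lo lo′ zero    same = refl
      costJ-window {f} {g} lo lo′ (suc k) same =
        if-cong (cong (p ≤ᵇ_) (same k ≤-refl)) (cong (2 +_) (costJ-window lo lo′ k same′))
                                               (cong (1 +_) (costI-window lo lo′ k same′))
        where
          same′ : ∀ x → x < k → f (lo + x) ≡ g (lo′ + x)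
          same′ x x<k = same x (m≤n⇒m≤1+n x<k)

  below-pred : ∀ {x y} → x < y → x ≤ y ∸ 1
  below-pred (s≤s x≤y) = x≤y

  pred-below : ∀ {x y} → x < y → y ∸ 1 < y
  pred-below {y = suc y} _ = ≤-refl

  pay-later : ∀ c k x → (k + c) + x ≡ c + (k + x)
  pay-later c k x = trans (cong (_+ x) (+-comm k c)) (+-assoc c k x)

  module Simulation (p q : ℕ) (p≤q : p ≤ q) (f : ℕ → ℕ) where
    open Scan p q

    -- State invariant while i is scanning: the window  i … j−1  still holds
    -- the input, A[j] ≤ q stops the scan at j, everything strictly between
    -- j and j₁ is ≤ q (so that moving A[j₁−1] to j keeps a stopper there),
    -- and i₁ ≤ i, so that writes at i₁ never touch the window.
    record LeftPhase (A : Array) (i i₁ j j₁ : ℕ) : Set where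
      field
        i₁≤i   : i₁ ≤ i
        i≤j    : i ≤ j
        j≤j₁   : j ≤ j₁
        unread : ∀ x → i ≤ x → x < j → A x ≡ f x
        Aj≤q   : A j ≤ q
        placed : ∀ x → j < x → x < j₁ → A x ≤ q

    record RightPhase (A : Array) (i i₁ j j₁ : ℕ) : Set where
      field
        i₁≤i   : i₁ ≤ i
        i≤j    : i ≤ j
        j<j₁   : j < j₁
        unread : ∀ x → i < x → x ≤ j → A x ≡ f x
        q<Ai   : q < A i
        placed : ∀ x → j < x → x < j₁ → A x ≤ q

    left-advance : ∀ {A A′ i i₁ i₁′ j j₁} → (∀ x → i < x → A′ x ≡ A x) → i₁′ ≤ suc i → i < j →
                   LeftPhase A i i₁ j j₁ → LeftPhase A′ (suc i) i₁′ j j₁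
    left-advance {A} {A′} {i} {j = j} agree i₁′≤ i<j inv = record
      { i₁≤i   = i₁′≤
      ; i≤j    = i<j
      ; j≤j₁   = j≤j₁
      ; unread = λ x i<x x<j → trans (agree x i<x) (unread x (<⇒≤ i<x) x<j)
      ; Aj≤q   = subst (_≤ q) (sym (agree j i<j)) Aj≤q
      ; placed = λ x j<x x<j₁ → subst (_≤ q) (sym (agree x (<-trans i<j j<x))) (placed x j<x x<j₁)
      }
      where open LeftPhase inv

    left-stop : ∀ {A i i₁ k j₁} → LeftPhase A i i₁ (suc (i + k)) j₁ → q < A i →
                RightPhase A i i₁ (i + k) j₁
    left-stop {A} {i} {k = k} {j₁} inv q<Ai = record
      { i₁≤i   = i₁≤i
      ; i≤j    = m≤m+n i k
      ; j<j₁   = j≤j₁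
      ; unread = λ x i<x x≤j → unread x (<⇒≤ i<x) (s≤s x≤j)
      ; q<Ai   = q<Ai
      ; placed = placed′
      }
      where
        open LeftPhase inv
        placed′ : ∀ x → i + k < x → x < j₁ → A x ≤ q
        placed′ x j<x x<j₁ with m≤n⇒m<n∨m≡n j<x
        ... | inj₁ j+1<x = placed x j+1<x x<j₁
        ... | inj₂ refl  = Aj≤q

    right-medium : ∀ {A i i₁ k j₁} → RightPhase A i i₁ (suc (i + k)) j₁ → f (suc (i + k)) ≤ q →
                   RightPhase A i i₁ (i + k) j₁
    right-medium {A} {i} {k = k} {j₁} inv fJ≤q = record
      { i₁≤i   = i₁≤i
      ; i≤j    = m≤m+n i k
      ; j<j₁   = <-trans (n<1+n _) j<j₁
      ; unread = λ x i<x x≤j → unread x i<x (m≤n⇒m≤1+n x≤j)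
      ; q<Ai   = q<Ai
      ; placed = placed′
      }
      where
        open RightPhase inv
        placed′ : ∀ x → i + k < x → x < j₁ → A x ≤ q
        placed′ x j<x x<j₁ with m≤n⇒m<n∨m≡n j<x
        ... | inj₁ j+1<x = placed x j+1<x x<j₁
        ... | inj₂ refl  = subst (_≤ q) (sym (unread x (s≤s (m≤m+n i k)) ≤-refl)) fJ≤q

    -- j passes a large element v: it goes to position j₁, and position j
    -- receives A[j₁−1], which is ≤ q.
    right-large : ∀ {A i i₁ k j₁} v → RightPhase A i i₁ (suc (i + k)) j₁ →
                  let Aᵤ = update A j₁ v
                  in RightPhase (update Aᵤ (suc (i + k)) (Aᵤ (j₁ ∸ 1))) i i₁ (i + k) (j₁ ∸ 1)
    right-large {A} {i} {i₁} {k} {j₁} v inv = record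
      { i₁≤i   = i₁≤i
      ; i≤j    = m≤m+n i k
      ; j<j₁   = below-pred j<j₁
      ; unread = λ x i<x x≤j → trans (agree x (s≤s x≤j)) (unread x i<x (m≤n⇒m≤1+n x≤j))
      ; q<Ai   = subst (q <_) (sym (agree i (s≤s (m≤m+n i k)))) q<Ai
      ; placed = placed′
      }
      where
        open RightPhase inv
        J : ℕ
        J = suc (i + k)
        Aᵤ A′ : Array
        Aᵤ = update A j₁ v
        A′ = update Aᵤ J (Aᵤ (j₁ ∸ 1))
        j₁-1<j₁ : j₁ ∸ 1 < j₁
        j₁-1<j₁ = pred-below j<j₁
        agree : ∀ x → x < J → A′ x ≡ A x
        agree x x<J = trans (update-other Aᵤ J _ x (<⇒≢ x<J)) (update-other A j₁ v x (<⇒≢ (<-trans x<J j<j₁)))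
        placed′ : ∀ x → i + k < x → x < j₁ ∸ 1 → A′ x ≤ q
        placed′ x j<x x<j₁-1 with m≤n⇒m<n∨m≡n j<x
        ... | inj₂ refl
          rewrite update-same Aᵤ J (Aᵤ (j₁ ∸ 1)) | update-other A j₁ v (j₁ ∸ 1) (<⇒≢ j₁-1<j₁)
          = placed (j₁ ∸ 1) x<j₁-1 j₁-1<j₁
        ... | inj₁ J<x
          rewrite update-other Aᵤ J (Aᵤ (j₁ ∸ 1)) x (>⇒≢ J<x)
                | update-other A j₁ v x (<⇒≢ (<-trans x<j₁-1 j₁-1<j₁))
          = placed x J<x (<-trans x<j₁-1 j₁-1<j₁)

    -- j stops on a small element: A[j] is moved to position i₁, the large
    -- A[i] to position j₁, and the vacated positions i, j are refilled from
    -- i₁+1 and j₁−1.  Afterwards i scans again, one step further right.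
    swap : ∀ {A i i₁ k j₁} v → RightPhase A i i₁ (suc (i + k)) j₁ → f (suc (i + k)) ≤ q →
           let J  = suc (i + k)
               A₁ = update A i₁ v
               A₂ = update A₁ j₁ (A₁ i)
               A₃ = update A₂ i (A₂ (suc i₁))
           in LeftPhase (update A₃ J (A₃ (j₁ ∸ 1))) (suc i) (suc i₁) J (j₁ ∸ 1)
    swap {A} {i} {i₁} {k} {j₁} v inv fJ≤q = record
      { i₁≤i   = s≤s i₁≤i
      ; i≤j    = i<J
      ; j≤j₁   = below-pred j<j₁
      ; unread = λ x i<x x<J → trans (agree x i<x (<-trans x<J j<j₁) (<⇒≢ x<J)) (unread x i<x (<⇒≤ x<J))
      ; Aj≤q   = A₄J≤q
      ; placed = λ x J<x x<j₁-1 →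
          subst (_≤ q) (sym (agree x (<-trans i<J J<x) (<-trans x<j₁-1 j₁-1<j₁) (>⇒≢ J<x)))
                (placed x J<x (<-trans x<j₁-1 j₁-1<j₁))
      }
      where
        open RightPhase inv
        J  = suc (i + k)
        A₁ A₂ A₃ A₄ : Array
        A₁ = update A i₁ v
        A₂ = update A₁ j₁ (A₁ i)
        A₃ = update A₂ i (A₂ (suc i₁))
        A₄ = update A₃ J (A₃ (j₁ ∸ 1))
        i<J : i < J
        i<J = s≤s (m≤m+n i k)
        j₁-1<j₁ : j₁ ∸ 1 < j₁
        j₁-1<j₁ = pred-below j<j₁
        -- between i and j₁, only position J is written by the four updates
        agree₃ : ∀ x → i < x → x < j₁ → A₃ x ≡ A x
        agree₃ x i<x x<j₁ =
          trans (update-other A₂ i _ x (>⇒≢ i<x))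
            (trans (update-other A₁ j₁ _ x (<⇒≢ x<j₁))
              (update-other A i₁ v x (>⇒≢ (≤-<-trans i₁≤i i<x))))
        agree : ∀ x → i < x → x < j₁ → x ≢ J → A₄ x ≡ A x
        agree x i<x x<j₁ x≢J = trans (update-other A₃ J _ x x≢J) (agree₃ x i<x x<j₁)
        A[j₁-1]≤q : A (j₁ ∸ 1) ≤ q
        A[j₁-1]≤q with m≤n⇒m<n∨m≡n (below-pred j<j₁)
        ... | inj₁ J<j₁-1 = placed (j₁ ∸ 1) J<j₁-1 j₁-1<j₁
        ... | inj₂ J≡j₁-1 = subst (λ x → A x ≤ q) J≡j₁-1 (subst (_≤ q) (sym (unread J i<J ≤-refl)) fJ≤q)
        A₄J≤q : A₄ J ≤ q
        A₄J≤q rewrite update-same A₃ J (A₃ (j₁ ∸ 1)) =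
          subst (_≤ q) (sym (agree₃ (j₁ ∸ 1) (<-≤-trans i<J (below-pred j<j₁)) j₁-1<j₁)) A[j₁-1]≤q

    small-move-agrees : ∀ A i i₁ v w → i₁ ≤ i → ∀ x → i < x → update (update A i₁ v) i w x ≡ A x
    small-move-agrees A i i₁ v w i₁≤i x i<x =
      trans (update-other (update A i₁ v) i w x (>⇒≢ i<x)) (update-other A i₁ v x (>⇒≢ (≤-<-trans i₁≤i i<x)))

    mutual
      runI : ∀ fuel k A i i₁ j j₁ c → j ≡ i + k → LeftPhase A i i₁ j j₁ → k < fuel →
             run fuel atI (st A i i₁ j j₁ p q c) ≡ c + costI f i k
      runI (suc fuel) zero A i i₁ j j₁ c j≡i+0 inv _ with trans j≡i+0 (+-identityʳ i)
      ... | refl rewrite ≤ᵇ-true (LeftPhase.Aj≤q inv) | ≤ᵇ-true (≤-refl {i}) = +-comm 1 c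
      runI (suc fuel) (suc k) A i i₁ j j₁ c j≡i+1+k inv (s≤s k<fuel) with trans j≡i+1+k (+-suc i k)
      ... | refl = scanI fuel k A i i₁ j₁ c inv k<fuel

      runJ : ∀ fuel k A i i₁ j j₁ c → j ≡ i + k → RightPhase A i i₁ j j₁ → k < fuel →
             run fuel atJ (st A i i₁ j j₁ p q c) ≡ c + costJ f (suc i) k
      runJ (suc fuel) zero A i i₁ j j₁ c j≡i+0 inv _ with trans j≡i+0 (+-identityʳ i)
      ... | refl rewrite ≤ᵇ-true (≤-trans p≤q (<⇒≤ (RightPhase.q<Ai inv))) | ≤ᵇ-true (≤-refl {i}) = +-comm 2 c
      runJ (suc fuel) (suc k) A i i₁ j j₁ c j≡i+1+k inv (s≤s k<fuel) with trans j≡i+1+k (+-suc i k)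
      ... | refl = scanJ fuel k A i i₁ j₁ c inv k<fuel

      scanI : ∀ fuel k A i i₁ j₁ c → LeftPhase A i i₁ (suc (i + k)) j₁ → k < fuel →
              run (suc fuel) atI (st A i i₁ (suc (i + k)) j₁ p q c) ≡ c + costI f i (suc k)
      scanI fuel k A i i₁ j₁ c inv k<fuel
        rewrite LeftPhase.unread inv i ≤-refl (s≤s (m≤m+n i k))
        with f i ≤ᵇ q | ≤ᵇ-reflects-≤ (f i) q
      ... | false | ofⁿ fi≰q =
        trans (runJ fuel k A i i₁ (i + k) j₁ (1 + c) refl (left-stop inv q<Ai) k<fuel) (pay-later c 1 _)
        where
          q<Ai : q < A i
          q<Ai = subst (q <_) (sym (LeftPhase.unread inv i ≤-refl (s≤s (m≤m+n i k)))) (≰⇒> fi≰q)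
      ... | true | _ rewrite ≤ᵇ-false {suc (i + k)} {i} (s≤s (m≤m+n i k)) with f i <ᵇ p
      ...   | true  = trans (runI fuel k _ (suc i) (suc i₁) (suc (i + k)) j₁ (2 + c) refl
                               (left-advance (small-move-agrees A i i₁ _ _ (LeftPhase.i₁≤i inv))
                                             (s≤s (LeftPhase.i₁≤i inv)) (s≤s (m≤m+n i k)) inv) k<fuel)
                            (pay-later c 2 _)
      ...   | false = trans (runI fuel k A (suc i) i₁ (suc (i + k)) j₁ (2 + c) refl
                               (left-advance (λ _ _ → refl) (m≤n⇒m≤1+n (LeftPhase.i₁≤i inv)) (s≤s (m≤m+n i k)) inv)
                               k<fuel)
                            (pay-later c 2 _)

      scanJ : ∀ fuel k A i i₁ j₁ c → RightPhase A i i₁ (suc (i + k)) j₁ → k < fuel →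
              run (suc fuel) atJ (st A i i₁ (suc (i + k)) j₁ p q c) ≡ c + costJ f (suc i) (suc k)
      scanJ fuel k A i i₁ j₁ c inv k<fuel
        rewrite RightPhase.unread inv (suc (i + k)) (s≤s (m≤m+n i k)) ≤-refl
        with p ≤ᵇ f (suc (i + k)) | ≤ᵇ-reflects-≤ p (f (suc (i + k)))
      ... | false | ofⁿ p≰fj =
        trans (runI fuel k _ (suc i) (suc i₁) (suc (i + k)) (j₁ ∸ 1) (1 + c) refl
                 (swap _ inv (≤-trans (<⇒≤ (≰⇒> p≰fj)) p≤q)) k<fuel)
              (pay-later c 1 _)
      ... | true | _ rewrite ≤ᵇ-false {suc (i + k)} {i} (s≤s (m≤m+n i k))
        with q <ᵇ f (suc (i + k)) | <ᵇ-reflects-< q (f (suc (i + k)))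
      ...   | true  | _ =
        trans (runJ fuel k _ i i₁ (i + k) (j₁ ∸ 1) (2 + c) refl (right-large _ inv) k<fuel) (pay-later c 2 _)
      ...   | false | ofⁿ q≮fj =
        trans (runJ fuel k A i i₁ (i + k) j₁ (2 + c) refl (right-medium inv (≮⇒≥ q≮fj)) k<fuel) (pay-later c 2 _)

module FirstStep where

  open import Defs
  open Prelim
  open Loops
  open import Data.Bool using (true; false; if_then_else_)
  open import Data.Nat
  open import Data.Nat.Properties
  open import Data.List using (List; []; _∷_; _∷ʳ_; length)
  open import Data.List.Properties using (length-++)
  open import Data.Empty using (⊥-elim)
  open import Relation.Nullary.Reflects using (ofʸ; ofⁿ)
  open import Relation.Binary.PropositionalEquality

  lowPivot highPivot : ℕ → ℕ → ℕ
  lowPivot  a b = if b <ᵇ a then b else a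
  highPivot a b = if b <ᵇ a then a else b

  lowPivot≤a : ∀ a b → lowPivot a b ≤ a
  lowPivot≤a a b with b <ᵇ a | <ᵇ-reflects-< b a
  ... | true  | ofʸ b<a = <⇒≤ b<a
  ... | false | ofⁿ _   = ≤-refl

  lowPivot≤b : ∀ a b → lowPivot a b ≤ b
  lowPivot≤b a b with b <ᵇ a | <ᵇ-reflects-< b a
  ... | true  | ofʸ _   = ≤-refl
  ... | false | ofⁿ b≮a = ≮⇒≥ b≮a

  a≤highPivot : ∀ a b → a ≤ highPivot a b
  a≤highPivot a b with b <ᵇ a | <ᵇ-reflects-< b a
  ... | true  | ofʸ _   = ≤-refl
  ... | false | ofⁿ b≮a = ≮⇒≥ b≮a

  b≤highPivot : ∀ a b → b ≤ highPivot a b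
  b≤highPivot a b with b <ᵇ a | <ᵇ-reflects-< b a
  ... | true  | ofʸ b<a = <⇒≤ b<a
  ... | false | ofⁿ _   = ≤-refl

  lowPivot≤highPivot : ∀ a b → lowPivot a b ≤ highPivot a b
  lowPivot≤highPivot a b = ≤-trans (lowPivot≤a a b) (a≤highPivot a b)

  enough-fuel : ∀ n → n < 4 * (2 + n) + 4
  enough-fuel n = s≤s (≤-trans (m≤m+n n _) (≤-trans (m≤m+n _ 4) (n≤1+n _)))

  firstPartition-loops : ∀ xs n → length xs ≡ 2 + n →
    let A = fromList xs; a = A 1; b = A (2 + n)
    in firstPartitionComparisons xs ≡ 1 + Scan.costI (lowPivot a b) (highPivot a b) A 2 n
  firstPartition-loops xs n len rewrite len =
    Simulation.runI p q (lowPivot≤highPivot a b) A (4 * (2 + n) + 4) n A 2 1 (2 + n) (2 + n) 1 refl start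
                    (enough-fuel n)
    where
      A : Array
      A = fromList xs
      a b p q : ℕ
      a = A 1
      b = A (2 + n)
      p = lowPivot a b
      q = highPivot a b
      start : Simulation.LeftPhase p q (lowPivot≤highPivot a b) A A 2 1 (2 + n) (2 + n)
      start = record
        { i₁≤i   = s≤s z≤n
        ; i≤j    = s≤s (s≤s z≤n)
        ; j≤j₁   = ≤-refl
        ; unread = λ _ _ _ → refl
        ; Aj≤q   = b≤highPivot a b
        ; placed = λ x n<x x<n → ⊥-elim (<-asym n<x x<n)
        }

  length-snoc : ∀ (π : List ℕ) y → length (π ∷ʳ y) ≡ suc (length π)
  length-snoc π y = trans (length-++ π) (+-comm (length π) 1)

  fromList-snoc-last : ∀ π y → fromList (π ∷ʳ y) (suc (length π)) ≡ y
  fromList-snoc-last []      y = refl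
  fromList-snoc-last (x ∷ π) y = fromList-snoc-last π y

  fromList-snoc-init : ∀ π y x → x < length π → fromList (π ∷ʳ y) (suc x) ≡ fromList π (suc x)
  fromList-snoc-init (z ∷ π) y zero    _         = refl
  fromList-snoc-init (z ∷ π) y (suc x) (s≤s x<n) = fromList-snoc-init π y x x<n

  module InnerCost (p q : ℕ) where
    open Scan p q

    innerI innerJ : List ℕ → ℕ
    innerI π = costI (fromList π) 1 (length π)
    innerJ π = costJ (fromList π) 1 (length π)

    innerI-cons : ∀ y π → innerI (y ∷ π) ≡ (if y ≤ᵇ q then 2 + innerI π else 1 + innerJ π)
    innerI-cons y π =
      if-cong refl (cong (2 +_) (costI-window 2 1 (length π) (λ _ _ → refl)))
                   (cong (1 +_) (costJ-window 2 1 (length π) (λ _ _ → refl)))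

    innerJ-snoc : ∀ π y → innerJ (π ∷ʳ y) ≡ (if p ≤ᵇ y then 2 + innerJ π else 1 + innerI π)
    innerJ-snoc π y rewrite length-snoc π y =
      if-cong (cong (p ≤ᵇ_) (fromList-snoc-last π y))
              (cong (2 +_) (costJ-window 1 1 (length π) (fromList-snoc-init π y)))
              (cong (1 +_) (costI-window 1 1 (length π) (fromList-snoc-init π y)))

  open InnerCost using (innerI; innerJ)

  firstPartition-inner : ∀ a b π →
    firstPartitionComparisons (a ∷ (π ∷ʳ b)) ≡ 1 + innerI (lowPivot a b) (highPivot a b) π
  firstPartition-inner a b π =
    begin
      firstPartitionComparisons (a ∷ (π ∷ʳ b))
    ≡⟨ firstPartition-loops (a ∷ (π ∷ʳ b)) n (cong suc (length-snoc π b)) ⟩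
      1 + Scan.costI (lowPivot a (A (2 + n))) (highPivot a (A (2 + n))) A 2 n
    ≡⟨ cong (λ c → 1 + Scan.costI (lowPivot a c) (highPivot a c) A 2 n) (fromList-snoc-last π b) ⟩
      1 + Scan.costI (lowPivot a b) (highPivot a b) A 2 n
    ≡⟨ cong (1 +_) (Scan.costI-window (lowPivot a b) (highPivot a b) 2 1 n (fromList-snoc-init π b)) ⟩
      1 + innerI (lowPivot a b) (highPivot a b) π
    ∎
    where
      open ≡-Reasoning
      n : ℕ
      n = length π
      A : Array
      A = fromList (a ∷ (π ∷ʳ b))

module Sums where

  open import Defs using (insertions; permutationsOf)
  open import Data.Nat
  open import Data.Nat.Properties
  open import Data.List using (List; []; _∷_; _++_; _∷ʳ_; map; concatMap; length)
  open import Data.Nat.ListAction using (sum)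
  open import Data.Product using (_×_; _,_; uncurry)
  open import Function using (_∘_)
  open import Relation.Binary.PropositionalEquality
  open import Algebra.Properties.CommutativeSemigroup +-commutativeSemigroup using (interchange; x∙yz≈y∙xz)

  Σ : ∀ {A : Set} → (A → ℕ) → List A → ℕ
  Σ f []       = 0
  Σ f (x ∷ xs) = f x + Σ f xs

  module _ {A : Set} where
    Σ-sum : ∀ (f : A → ℕ) xs → sum (map f xs) ≡ Σ f xs
    Σ-sum f []       = refl
    Σ-sum f (x ∷ xs) = cong (f x +_) (Σ-sum f xs)

    Σ-cong : ∀ {f g : A → ℕ} → (∀ x → f x ≡ g x) → ∀ xs → Σ f xs ≡ Σ g xs
    Σ-cong f≗g []       = refl
    Σ-cong f≗g (x ∷ xs) = cong₂ _+_ (f≗g x) (Σ-cong f≗g xs)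

    Σ-++ : ∀ (f : A → ℕ) xs ys → Σ f (xs ++ ys) ≡ Σ f xs + Σ f ys
    Σ-++ f []       ys = refl
    Σ-++ f (x ∷ xs) ys = trans (cong (f x +_) (Σ-++ f xs ys)) (sym (+-assoc (f x) _ _))

    Σ-+ : ∀ (f g : A → ℕ) xs → Σ (λ x → f x + g x) xs ≡ Σ f xs + Σ g xs
    Σ-+ f g []       = refl
    Σ-+ f g (x ∷ xs) = trans (cong (f x + g x +_) (Σ-+ f g xs)) (interchange (f x) (g x) (Σ f xs) (Σ g xs))

    Σ-* : ∀ c (f : A → ℕ) xs → Σ (λ x → c * f x) xs ≡ c * Σ f xs
    Σ-* c f []       = sym (*-zeroʳ c)
    Σ-* c f (x ∷ xs) = trans (cong (c * f x +_) (Σ-* c f xs)) (sym (*-distribˡ-+ c (f x) _))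

    Σ-const : ∀ c (xs : List A) → Σ (λ _ → c) xs ≡ c * length xs
    Σ-const c []       = sym (*-zeroʳ c)
    Σ-const c (x ∷ xs) = trans (cong (c +_) (Σ-const c xs)) (sym (*-suc c _))

  module _ {A B : Set} where
    Σ-map : ∀ (f : B → ℕ) (g : A → B) xs → Σ f (map g xs) ≡ Σ (f ∘ g) xs
    Σ-map f g []       = refl
    Σ-map f g (x ∷ xs) = cong (f (g x) +_) (Σ-map f g xs)

    Σ-concatMap : ∀ (f : B → ℕ) (g : A → List B) xs → Σ f (concatMap g xs) ≡ Σ (λ x → Σ f (g x)) xs
    Σ-concatMap f g []       = refl
    Σ-concatMap f g (x ∷ xs) = trans (Σ-++ f (g x) _) (cong (Σ f (g x) +_) (Σ-concatMap f g xs))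

  Σperm : (List ℕ → ℕ) → List ℕ → ℕ
  Σperm f X = Σ f (permutationsOf X)

  Σperm-cong : ∀ {f g} → (∀ π → f π ≡ g π) → ∀ X → Σperm f X ≡ Σperm g X
  Σperm-cong f≗g X = Σ-cong f≗g (permutationsOf X)

  putBack : ∀ {A : Set} → A → A × List A → A × List A
  putBack x (y , r) = (y , x ∷ r)

  select : ∀ {A : Set} → List A → List (A × List A)
  select []       = []
  select (x ∷ xs) = (x , xs) ∷ map (putBack x) (select xs)

  Σperm-insert : ∀ f x xs → Σperm f (x ∷ xs) ≡ Σperm (λ σ → Σ f (insertions x σ)) xs
  Σperm-insert f x xs = Σ-concatMap f (insertions x) (permutationsOf xs)

  laterInsertions : ℕ → (List ℕ → ℕ) → List ℕ → ℕ
  laterInsertions x f []       = 0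
  laterInsertions x f (y ∷ ys) = Σ (f ∘ (y ∷_)) (insertions x ys)

  Σ-insertions-first : ∀ x f σ → Σ f (insertions x σ) ≡ f (x ∷ σ) + laterInsertions x f σ
  Σ-insertions-first x f []       = refl
  Σ-insertions-first x f (y ∷ ys) = cong (f (x ∷ y ∷ ys) +_) (Σ-map f (y ∷_) (insertions x ys))

  Σperm-first : ∀ f x xs →
    Σperm f (x ∷ xs) ≡ Σ (uncurry λ y r → Σperm (f ∘ (y ∷_)) r) (select (x ∷ xs))
  Σperm-first f x []       = sym (+-identityʳ _)
  Σperm-first f x (z ∷ zs) =
    begin
      Σperm f (x ∷ z ∷ zs)
    ≡⟨ Σperm-insert f x (z ∷ zs) ⟩
      Σperm (λ σ → Σ f (insertions x σ)) (z ∷ zs)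
    ≡⟨ Σperm-cong (Σ-insertions-first x f) (z ∷ zs) ⟩
      Σperm (λ σ → f (x ∷ σ) + laterInsertions x f σ) (z ∷ zs)
    ≡⟨ Σ-+ (f ∘ (x ∷_)) (laterInsertions x f) (permutationsOf (z ∷ zs)) ⟩
      Σperm (f ∘ (x ∷_)) (z ∷ zs) + Σperm (laterInsertions x f) (z ∷ zs)
    ≡⟨ cong (Σperm (f ∘ (x ∷_)) (z ∷ zs) +_) later ⟩
      Σperm (f ∘ (x ∷_)) (z ∷ zs) + Σ G (map (putBack x) (select (z ∷ zs)))
    ∎
    where
      open ≡-Reasoning
      G : ℕ × List ℕ → ℕ
      G = uncurry λ y r → Σperm (f ∘ (y ∷_)) r
      later : Σperm (laterInsertions x f) (z ∷ zs) ≡ Σ G (map (putBack x) (select (z ∷ zs)))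
      later =
        begin
          Σperm (laterInsertions x f) (z ∷ zs)
        ≡⟨ Σperm-first (laterInsertions x f) z zs ⟩
          Σ (uncurry λ y r → Σperm (laterInsertions x f ∘ (y ∷_)) r) (select (z ∷ zs))
        ≡⟨ Σ-cong (λ (y , r) → sym (Σperm-insert (f ∘ (y ∷_)) x r)) (select (z ∷ zs)) ⟩
          Σ (G ∘ putBack x) (select (z ∷ zs))
        ≡⟨ Σ-map G (putBack x) (select (z ∷ zs)) ⟨
          Σ G (map (putBack x) (select (z ∷ zs)))
        ∎

  earlierInsertions : ℕ → (List ℕ → ℕ) → List ℕ → ℕ
  earlierInsertions x f []       = 0
  earlierInsertions x f (y ∷ ys) = f (x ∷ y ∷ ys) + earlierInsertions x (f ∘ (y ∷_)) ys

  Σ-insertions-last : ∀ x f σ → Σ f (insertions x σ) ≡ f (σ ∷ʳ x) + earlierInsertions x f σ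
  Σ-insertions-last x f []       = refl
  Σ-insertions-last x f (y ∷ ys) =
    trans (cong (f (x ∷ y ∷ ys) +_) (trans (Σ-map f (y ∷_) (insertions x ys))
                                           (Σ-insertions-last x (f ∘ (y ∷_)) ys)))
          (x∙yz≈y∙xz (f (x ∷ y ∷ ys)) (f (y ∷ (ys ∷ʳ x))) _)

  earlierInsertions-snoc : ∀ x f σ z →
    earlierInsertions x f (σ ∷ʳ z) ≡ Σ (λ ρ → f (ρ ∷ʳ z)) (insertions x σ)
  earlierInsertions-snoc x f []       z = refl
  earlierInsertions-snoc x f (y ∷ ys) z =
    cong (f (x ∷ y ∷ (ys ∷ʳ z)) +_)
         (trans (earlierInsertions-snoc x (f ∘ (y ∷_)) ys z)
                (sym (Σ-map (λ ρ → f (ρ ∷ʳ z)) (y ∷_) (insertions x ys))))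

  Σperm-last : ∀ f x xs →
    Σperm f (x ∷ xs) ≡ Σ (uncurry λ y r → Σperm (λ π → f (π ∷ʳ y)) r) (select (x ∷ xs))
  Σperm-last f x []       = sym (+-identityʳ _)
  Σperm-last f x (z ∷ zs) =
    begin
      Σperm f (x ∷ z ∷ zs)
    ≡⟨ Σperm-insert f x (z ∷ zs) ⟩
      Σperm (λ σ → Σ f (insertions x σ)) (z ∷ zs)
    ≡⟨ Σperm-cong (Σ-insertions-last x f) (z ∷ zs) ⟩
      Σperm (λ σ → f (σ ∷ʳ x) + earlierInsertions x f σ) (z ∷ zs)
    ≡⟨ Σ-+ (λ σ → f (σ ∷ʳ x)) (earlierInsertions x f) (permutationsOf (z ∷ zs)) ⟩
      Σperm (λ σ → f (σ ∷ʳ x)) (z ∷ zs) + Σperm (earlierInsertions x f) (z ∷ zs)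
    ≡⟨ cong (Σperm (λ σ → f (σ ∷ʳ x)) (z ∷ zs) +_) earlier ⟩
      Σperm (λ σ → f (σ ∷ʳ x)) (z ∷ zs) + Σ G (map (putBack x) (select (z ∷ zs)))
    ∎
    where
      open ≡-Reasoning
      G : ℕ × List ℕ → ℕ
      G = uncurry λ y r → Σperm (λ π → f (π ∷ʳ y)) r
      earlier : Σperm (earlierInsertions x f) (z ∷ zs) ≡ Σ G (map (putBack x) (select (z ∷ zs)))
      earlier =
        begin
          Σperm (earlierInsertions x f) (z ∷ zs)
        ≡⟨ Σperm-last (earlierInsertions x f) z zs ⟩
          Σ (uncurry λ y r → Σperm (λ π → earlierInsertions x f (π ∷ʳ y)) r) (select (z ∷ zs))
        ≡⟨ Σ-cong (λ (y , r) → trans (Σperm-cong (λ π → earlierInsertions-snoc x f π y) r)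
                                     (sym (Σperm-insert (λ π → f (π ∷ʳ y)) x r)))
                  (select (z ∷ zs)) ⟩
          Σ (G ∘ putBack x) (select (z ∷ zs))
        ≡⟨ Σ-map G (putBack x) (select (z ∷ zs)) ⟨
          Σ G (map (putBack x) (select (z ∷ zs)))
        ∎

  -- y ∷ r has the same sums as X, i.e. r is X with one occurrence of y
  -- removed (up to order).  This is all that sums over  select X  see.
  record Splits (X : List ℕ) (y : ℕ) (r : List ℕ) : Set where
    constructor splits
    field sums : ∀ (f : ℕ → ℕ) → Σ f X ≡ f y + Σ f r

  Σ-select : ∀ X (g : ℕ → List ℕ → ℕ) (h : ℕ → ℕ) → (∀ y r → Splits X y r → g y r ≡ h y) →
             Σ (uncurry g) (select X) ≡ Σ h X
  Σ-select []       g h g≡h = refl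
  Σ-select (x ∷ xs) g h g≡h =
    cong₂ _+_ (g≡h x xs (splits λ f → refl))
              (trans (Σ-map (uncurry g) (putBack x) (select xs))
                     (Σ-select xs (λ y r → g y (x ∷ r)) h
                        (λ y r s → g≡h y (x ∷ r) (splits λ f →
                          trans (cong (f x +_) (Splits.sums s f)) (x∙yz≈y∙xz (f x) (f y) (Σ f r))))))

  length-splits : ∀ {X y r} → Splits X y r → length X ≡ suc (length r)
  length-splits {X} {y} {r} s =
    trans (sym (Σ-one X)) (trans (Splits.sums s (λ _ → 1)) (cong suc (Σ-one r)))
    where
      Σ-one : ∀ (xs : List ℕ) → Σ (λ _ → 1) xs ≡ length xs
      Σ-one xs = trans (Σ-const 1 xs) (*-identityˡ (length xs))

module Counting where

  open import Defs
  open Prelim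
  open FirstStep
  open Sums
  open import Data.Bool using (true; false; if_then_else_)
  open import Data.Nat
  open import Data.Nat.Properties
  open import Data.List using (List; []; _∷_; _∷ʳ_; length)
  open import Data.Product using (_,_; uncurry)
  open import Function using (_∘_)
  open import Relation.Nullary.Reflects using (ofʸ; ofⁿ)
  open import Relation.Binary.PropositionalEquality
  open import Data.Nat.Tactic.RingSolver using (solve-∀)

  count-permutations : ∀ N X → length X ≡ N → Σperm (λ _ → 1) X ≡ N !
  count-permutations zero    []       _   = refl
  count-permutations (suc N) (x ∷ xs) len =
    begin
      Σperm (λ _ → 1) (x ∷ xs)
    ≡⟨ Σperm-first (λ _ → 1) x xs ⟩
      Σ (uncurry λ y r → Σperm (λ _ → 1) r) (select (x ∷ xs))
    ≡⟨ Σ-select (x ∷ xs) _ (λ _ → N !) (λ y r s → count-permutations N r (length-rest s)) ⟩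
      Σ (λ _ → N !) (x ∷ xs)
    ≡⟨ Σ-const (N !) (x ∷ xs) ⟩
      N ! * suc (length xs)
    ≡⟨ cong (N ! *_) len ⟩
      N ! * suc N
    ≡⟨ *-comm (N !) (suc N) ⟩
      suc N !
    ∎
    where
      open ≡-Reasoning
      length-rest : ∀ {y r} → Splits (x ∷ xs) y r → length r ≡ N
      length-rest s = suc-injective (trans (sym (length-splits s)) len)

  Σperm-shift : ∀ N X c g → length X ≡ N → Σperm (λ π → c + g π) X ≡ c * N ! + Σperm g X
  Σperm-shift N X c g len =
    trans (Σ-+ (λ _ → c) g (permutationsOf X))
          (cong (_+ Σperm g X) (trans (Σperm-cong (λ _ → sym (*-identityʳ c)) X)
                                      (trans (Σ-* c (λ _ → 1) (permutationsOf X))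
                                             (cong (c *_) (count-permutations N X len)))))

  data Class : Set where
    small medium large : Class

  ind : Class → Class → ℕ
  ind small  small  = 1
  ind medium medium = 1
  ind large  large  = 1
  ind _      _      = 0

  by-indicators : ∀ (h : Class → ℕ) c →
    h c ≡ h small * ind small c + h medium * ind medium c + h large * ind large c
  by-indicators h small  = pick (h small) (h medium) (h large)
    where pick : ∀ a b c → a ≡ a * 1 + b * 0 + c * 0
          pick = solve-∀
  by-indicators h medium = pick (h small) (h medium) (h large)
    where pick : ∀ a b c → b ≡ a * 0 + b * 1 + c * 0
          pick = solve-∀
  by-indicators h large  = pick (h small) (h medium) (h large)
    where pick : ∀ a b c → c ≡ a * 0 + b * 0 + c * 1
          pick = solve-∀

  data Side : Set where
    left right : Side

  read : Side → ℕ → List ℕ → List ℕ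
  read left  y π = y ∷ π
  read right y π = π ∷ʳ y

  price : Side → Class → ℕ
  price _     medium = 2
  price left  small  = 2
  price left  large  = 1
  price right small  = 1
  price right large  = 2

  next : Side → Class → Side
  next σ     medium = σ
  next left  small  = left
  next left  large  = right
  next right small  = left
  next right large  = right

  -- The last test, on the already classified element at i = j.
  final : Side → ℕ
  final left  = 1
  final right = 2

  Σperm-read : ∀ σ f x xs →
    Σperm f (x ∷ xs) ≡ Σ (uncurry λ y r → Σperm (f ∘ read σ y) r) (select (x ∷ xs))
  Σperm-read left  = Σperm-first
  Σperm-read right = Σperm-last

  -- Total loop cost over all N! orderings of N inner elements, s of them
  -- small, m medium and l large, when pointer σ is active; readCost is the
  -- part in which the first element read is of class c.
  mutual
    permCost : Side → ℕ → ℕ → ℕ → ℕ → ℕ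
    permCost σ zero    s m l = final σ
    permCost σ (suc N) s m l =
      readCost σ N s m l small * s + readCost σ N s m l medium * m + readCost σ N s m l large * l

    readCost : Side → ℕ → ℕ → ℕ → ℕ → Class → ℕ
    readCost σ N s m l c =
      price σ c * N ! + permCost (next σ c) N (s ∸ ind small c) (m ∸ ind medium c) (l ∸ ind large c)

  module Classify (p q : ℕ) (p≤q : p ≤ q) where
    open InnerCost p q

    class : ℕ → Class
    class y = if y <ᵇ p then small else (if q <ᵇ y then large else medium)

    count : Class → List ℕ → ℕ
    count c = Σ (λ x → ind c (class x))

    Σ-by-class : ∀ (h : Class → ℕ) X →
      Σ (h ∘ class) X ≡ h small * count small X + h medium * count medium X + h large * count large X
    Σ-by-class h X =
      begin
        Σ (h ∘ class) X
      ≡⟨ Σ-cong (by-indicators h ∘ class) X ⟩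
        Σ (λ x → Ind small x + Ind medium x + Ind large x) X
      ≡⟨ Σ-+ (λ x → Ind small x + Ind medium x) (Ind large) X ⟩
        Σ (λ x → Ind small x + Ind medium x) X + Σ (Ind large) X
      ≡⟨ cong (_+ Σ (Ind large) X) (Σ-+ (Ind small) (Ind medium) X) ⟩
        Σ (Ind small) X + Σ (Ind medium) X + Σ (Ind large) X
      ≡⟨ cong₂ _+_ (cong₂ _+_ (Σ-* (h small) _ X) (Σ-* (h medium) _ X)) (Σ-* (h large) _ X) ⟩
        h small * count small X + h medium * count medium X + h large * count large X
      ∎
      where
        open ≡-Reasoning
        Ind : Class → ℕ → ℕ
        Ind c x = h c * ind c (class x)

    count-rest : ∀ {X y r} c → Splits X y r → count c r ≡ count c X ∸ ind c (class y)
    count-rest {X} {y} {r} c s =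
      sym (trans (cong (_∸ ind c (class y)) (Splits.sums s (λ x → ind c (class x))))
                 (m+n∸m≡n (ind c (class y)) (count c r)))

    count-total : ∀ X → count small X + count medium X + count large X ≡ length X
    count-total X =
      begin
        count small X + count medium X + count large X
      ≡⟨ cong₂ _+_ (cong₂ _+_ (*-identityˡ (count small X)) (*-identityˡ (count medium X)))
                   (*-identityˡ (count large X)) ⟨
        1 * count small X + 1 * count medium X + 1 * count large X
      ≡⟨ Σ-by-class (λ _ → 1) X ⟨
        Σ (λ _ → 1) X
      ≡⟨ Σ-const 1 X ⟩
        1 * length X
      ≡⟨ *-identityˡ (length X) ⟩
        length X
      ∎
      where open ≡-Reasoning

    inner : Side → List ℕ → ℕ
    inner left  = innerI
    inner right = innerJ

    inner-read : ∀ σ y π → inner σ (read σ y π) ≡ price σ (class y) + inner (next σ (class y)) π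
    inner-read left y π rewrite innerI-cons y π with y <ᵇ p | <ᵇ-reflects-< y p
    ... | true  | ofʸ y<p rewrite ≤ᵇ-true (≤-trans (<⇒≤ y<p) p≤q) = refl
    ... | false | ofⁿ _ with q <ᵇ y | <ᵇ-reflects-< q y
    ...   | true  | ofʸ q<y rewrite ≤ᵇ-false q<y = refl
    ...   | false | ofⁿ q≮y rewrite ≤ᵇ-true (≮⇒≥ q≮y) = refl
    inner-read right y π rewrite innerJ-snoc π y with y <ᵇ p | <ᵇ-reflects-< y p
    ... | true  | ofʸ y<p rewrite ≤ᵇ-false y<p = refl
    ... | false | ofⁿ y≮p rewrite ≤ᵇ-true (≮⇒≥ y≮p) with q <ᵇ y
    ...   | true  = refl
    ...   | false = refl

    Σperm-inner : ∀ σ N X → length X ≡ N →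
      Σperm (inner σ) X ≡ permCost σ N (count small X) (count medium X) (count large X)
    Σperm-inner left  zero    []       _   = refl
    Σperm-inner right zero    []       _   = refl
    Σperm-inner σ (suc N) (x ∷ xs) len =
      begin
        Σperm (inner σ) X
      ≡⟨ Σperm-read σ (inner σ) x xs ⟩
        Σ (uncurry λ y r → Σperm (inner σ ∘ read σ y) r) (select X)
      ≡⟨ Σ-select X _ (readCost σ N s m l ∘ class) first-read ⟩
        Σ (readCost σ N s m l ∘ class) X
      ≡⟨ Σ-by-class (readCost σ N s m l) X ⟩
        permCost σ (suc N) s m l
      ∎
      where
        open ≡-Reasoning
        X : List ℕ
        X = x ∷ xs
        s m l : ℕ
        s = count small X
        m = count medium X
        l = count large X
        first-read : ∀ y r → Splits X y r → Σperm (inner σ ∘ read σ y) r ≡ readCost σ N s m l (class y)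
        first-read y r split =
          begin
            Σperm (inner σ ∘ read σ y) r
          ≡⟨ Σperm-cong (inner-read σ y) r ⟩
            Σperm (λ π → price σ c + inner (next σ c) π) r
          ≡⟨ Σperm-shift N r (price σ c) (inner (next σ c)) |r| ⟩
            price σ c * N ! + Σperm (inner (next σ c)) r
          ≡⟨ cong (price σ c * N ! +_) (Σperm-inner (next σ c) N r |r|) ⟩
            price σ c * N ! + permCost (next σ c) N (count small r) (count medium r) (count large r)
          ≡⟨ cong (λ (u , v , w) → price σ c * N ! + permCost (next σ c) N u v w)
                  (cong₂ _,_ (count-rest small split) (cong₂ _,_ (count-rest medium split) (count-rest large split))) ⟩
            readCost σ N s m l c
          ∎
          where
            c : Class
            c = class y
            |r| : length r ≡ N
            |r| = suc-injective (trans (sym (length-splits split)) len)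

    small-indicator : ∀ x → ind small (class x) ≡ (if x <ᵇ p then 1 else 0)
    small-indicator x with x <ᵇ p
    ... | true  = refl
    ... | false with q <ᵇ x
    ...   | true  = refl
    ...   | false = refl

    large-indicator : ∀ x → ind large (class x) ≡ (if q <ᵇ x then 1 else 0)
    large-indicator x with x <ᵇ p | <ᵇ-reflects-< x p
    ... | true  | ofʸ x<p rewrite <ᵇ-false (≤-trans (<⇒≤ x<p) p≤q) = refl
    ... | false | _ with q <ᵇ x
    ...   | true  = refl
    ...   | false = refl

    medium-class : ∀ x → p ≤ x → x ≤ q → class x ≡ medium
    medium-class x p≤x x≤q rewrite <ᵇ-false p≤x | <ᵇ-false x≤q = refl

module ClosedForm where

  open Counting using (Side; left; right; Class; small; medium; large; ind; price; next; final; permCost; readCost)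
  open import Data.Nat as ℕ using (ℕ; zero; suc; _!; _∸_)
  import Data.Nat.Properties as ℕ
  open import Data.Integer using (ℤ; +_; _+_; _*_; _-_; ≢-nonZero)
  open import Data.Integer.Properties using (pos-+; pos-*; +-injective; *-cancelˡ-≡)
  open import Relation.Binary.PropositionalEquality
  open import Data.Integer.Tactic.RingSolver using (solve-∀)
  import Data.Nat.Tactic.RingSolver as ℕ-Solver

  closed : Side → ℤ → ℤ → ℤ → ℤ → ℤ
  closed left  ν S L F = F * ((+ 2 * ν + + 1) * (S + L) - + 2 * S * L)
  closed right ν S L F = F * (+ 2 * ν * (S + L) + + 2 * L - + 2 * S * L)

  ClosedFormAt : ℕ → ℕ → ℕ → ℕ → Side → Set
  ClosedFormAt N s m l σ = (+ s + + l) * + permCost σ N s m l ≡ closed σ (+ N) (+ s) (+ l) (+ (N !))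

  -- When all inner elements are medium, every one costs two comparisons.
  all-medium-step : ∀ F N e X Y →
    X ℕ.* 0 ℕ.+ (2 ℕ.* F ℕ.+ F ℕ.* (2 ℕ.* N ℕ.+ e)) ℕ.* suc N ℕ.+ Y ℕ.* 0
      ≡ (suc N ℕ.* F) ℕ.* (2 ℕ.* suc N ℕ.+ e)
  all-medium-step = ℕ-Solver.solve-∀

  all-medium : ∀ σ N → permCost σ N 0 N 0 ≡ N ! ℕ.* (2 ℕ.* N ℕ.+ final σ)
  all-medium σ zero = sym (ℕ.+-identityʳ (final σ))
  all-medium σ (suc N) = trans (cong (λ x → X ℕ.* 0 ℕ.+ (2 ℕ.* N ! ℕ.+ x) ℕ.* suc N ℕ.+ Y ℕ.* 0) (all-medium σ N))
    (all-medium-step (N !) N (final σ) X Y)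
    where
      X Y : ℕ
      X = readCost σ N 0 (suc N) 0 small
      Y = readCost σ N 0 (suc N) 0 large

  readCostℤ : Side → ℕ → ℕ → ℕ → ℕ → Class → ℤ
  readCostℤ σ N s m l c =
    + price σ c * + (N !) + + permCost (next σ c) N (s ∸ ind small c) (m ∸ ind medium c) (l ∸ ind large c)

  cast-affine : ∀ a b c → + (a ℕ.* b ℕ.+ c) ≡ + a * + b + + c
  cast-affine a b c = trans (pos-+ (a ℕ.* b) c) (cong (_+ + c) (pos-* a b))

  cast-combination : ∀ a b c d e f →
    + (a ℕ.* b ℕ.+ c ℕ.* d ℕ.+ e ℕ.* f) ≡ + a * + b + + c * + d + + e * + f
  cast-combination a b c d e f =
    trans (pos-+ (a ℕ.* b ℕ.+ c ℕ.* d) (e ℕ.* f))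
          (cong₂ _+_ (trans (pos-+ (a ℕ.* b) (c ℕ.* d)) (cong₂ _+_ (pos-* a b) (pos-* c d))) (pos-* e f))

  permCost-sucℤ : ∀ σ N s m l → + permCost σ (suc N) s m l
    ≡ readCostℤ σ N s m l small * + s + readCostℤ σ N s m l medium * + m + readCostℤ σ N s m l large * + l
  permCost-sucℤ σ N s m l =
    trans (cast-combination (R small) s (R medium) m (R large) l)
          (cong₂ _+_ (cong₂ _+_ (cong (_* + s) (read small)) (cong (_* + m) (read medium)))
                     (cong (_* + l) (read large)))
    where
      R : Class → ℕ
      R = readCost σ N s m l
      read : ∀ c → + R c ≡ readCostℤ σ N s m l c
      read c = cast-affine (price σ c) (N !) _

  -- Multiplying the recursion by S + L − 1 separates the three cases of the
  -- first element read.
  separate : ∀ S M L F A B C ps pm pl →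
    (S + L - + 1) * ((S + L) * ((ps * F + A) * S + (pm * F + B) * M + (pl * F + C) * L))
      ≡ (S + L) * (S * ((S + L - + 1) * A)) + (S + L - + 1) * (M * ((S + L) * B))
        + (S + L) * (L * ((S + L - + 1) * C))
        + (S + L - + 1) * (S + L) * (ps * F * S + pm * F * M + pl * F * L)
  separate = solve-∀

  -- The closed forms of the three cases combine to the closed form for one
  -- more element (M = ν + 1 − S − L).
  combine-left : ∀ S L F ν →
    (S + L) * (S * (F * ((+ 2 * ν + + 1) * ((S - + 1) + L) - + 2 * (S - + 1) * L)))
    + (S + L - + 1) * ((+ 1 + ν - S - L) * (F * ((+ 2 * ν + + 1) * (S + L) - + 2 * S * L)))
    + (S + L) * (L * (F * (+ 2 * ν * (S + (L - + 1)) + + 2 * (L - + 1) - + 2 * S * (L - + 1))))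
    + (S + L - + 1) * (S + L) * (+ 2 * F * S + + 2 * F * (+ 1 + ν - S - L) + + 1 * F * L)
      ≡ (S + L - + 1) * (((+ 1 + ν) * F) * ((+ 2 * (+ 1 + ν) + + 1) * (S + L) - + 2 * S * L))
  combine-left = solve-∀

  combine-right : ∀ S L F ν →
    (S + L) * (S * (F * ((+ 2 * ν + + 1) * ((S - + 1) + L) - + 2 * (S - + 1) * L)))
    + (S + L - + 1) * ((+ 1 + ν - S - L) * (F * (+ 2 * ν * (S + L) + + 2 * L - + 2 * S * L)))
    + (S + L) * (L * (F * (+ 2 * ν * (S + (L - + 1)) + + 2 * (L - + 1) - + 2 * S * (L - + 1))))
    + (S + L - + 1) * (S + L) * (+ 1 * F * S + + 2 * F * (+ 1 + ν - S - L) + + 2 * F * L)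
      ≡ (S + L - + 1) * (((+ 1 + ν) * F) * (+ 2 * (+ 1 + ν) * (S + L) + + 2 * L - + 2 * S * L))
  combine-right = solve-∀

  combine : ∀ σ S L F ν → let M = + 1 + ν - S - L in
    (S + L) * (S * closed (next σ small) ν (S - + 1) L F)
    + (S + L - + 1) * (M * closed (next σ medium) ν S L F)
    + (S + L) * (L * closed (next σ large) ν S (L - + 1) F)
    + (S + L - + 1) * (S + L) * (+ price σ small * F * S + + price σ medium * F * M + + price σ large * F * L)
      ≡ (S + L - + 1) * closed σ (+ 1 + ν) S L ((+ 1 + ν) * F)
  combine left  = combine-left
  combine right = combine-right

  -- The inductive step when at least two inner elements are extreme.
  step-algebra : ∀ σ {S M L F ν A B C} → M ≡ + 1 + ν - S - L → S + L - + 1 ≢ + 0 →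
    S * ((S + L - + 1) * A) ≡ S * closed (next σ small) ν (S - + 1) L F →
    M * ((S + L) * B) ≡ M * closed (next σ medium) ν S L F →
    L * ((S + L - + 1) * C) ≡ L * closed (next σ large) ν S (L - + 1) F →
    (S + L) * ((+ price σ small * F + A) * S + (+ price σ medium * F + B) * M + (+ price σ large * F + C) * L)
      ≡ closed σ (+ 1 + ν) S L ((+ 1 + ν) * F)
  step-algebra σ {S} {M} {L} {F} {ν} {A} {B} {C} refl k≢0 hS hM hL =
    *-cancelˡ-≡ (S + L - + 1) _ _ {{≢-nonZero k≢0}}
      (trans (separate S M L F A B C (+ price σ small) (+ price σ medium) (+ price σ large))
        (trans (cong (_+ _) (cong₂ _+_ (cong₂ _+_ (cong ((S + L) *_) hS) (cong ((S + L - + 1) *_) hM))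
                                       (cong ((S + L) *_) hL)))
               (combine σ S L F ν)))

  none-left : ∀ ν F → + 0 ≡ F * ((+ 2 * ν + + 1) * (+ 0 + + 0) - + 2 * + 0 * + 0)
  none-left = solve-∀

  none-right : ∀ ν F → + 0 ≡ F * (+ 2 * ν * (+ 0 + + 0) + + 2 * + 0 - + 2 * + 0 * + 0)
  none-right = solve-∀

  closed-none : ∀ σ ν F → + 0 ≡ closed σ ν (+ 0) (+ 0) F
  closed-none left  = none-left
  closed-none right = none-right

  -- Exactly one extreme element, small: after reading it all elements are
  -- medium (A), after reading a medium one the extreme one remains (B).
  isolate-small : ∀ F ν A B C ps pm pl →
    (+ 1 + + 0) * ((ps * F + A) * + 1 + (pm * F + B) * ν + (pl * F + C) * + 0)
      ≡ ps * F + A + pm * F * ν + ν * ((+ 1 + + 0) * B)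
  isolate-small = solve-∀

  finish-small-left : ∀ F ν →
    + 2 * F + F * (+ 2 * ν + + 1) + + 2 * F * ν
    + ν * (F * ((+ 2 * ν + + 1) * (+ 1 + + 0) - + 2 * + 1 * + 0))
      ≡ ((+ 1 + ν) * F) * ((+ 2 * (+ 1 + ν) + + 1) * (+ 1 + + 0) - + 2 * + 1 * + 0)
  finish-small-left = solve-∀

  finish-small-right : ∀ F ν →
    + 1 * F + F * (+ 2 * ν + + 1) + + 2 * F * ν
    + ν * (F * (+ 2 * ν * (+ 1 + + 0) + + 2 * + 0 - + 2 * + 1 * + 0))
      ≡ ((+ 1 + ν) * F) * (+ 2 * (+ 1 + ν) * (+ 1 + + 0) + + 2 * + 0 - + 2 * + 1 * + 0)
  finish-small-right = solve-∀

  single-small : ∀ σ F ν A B C → A ≡ F * (+ 2 * ν + + final (next σ small)) →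
    ν * ((+ 1 + + 0) * B) ≡ ν * closed (next σ medium) ν (+ 1) (+ 0) F →
    (+ 1 + + 0) * ((+ price σ small * F + A) * + 1 + (+ price σ medium * F + B) * ν + (+ price σ large * F + C) * + 0)
      ≡ closed σ (+ 1 + ν) (+ 1) (+ 0) ((+ 1 + ν) * F)
  single-small σ F ν A B C refl hM =
    trans (isolate-small F ν A B C (+ price σ small) (+ price σ medium) (+ price σ large))
          (trans (cong (λ x → + price σ small * F + A + + price σ medium * F * ν + x) hM) (finish σ))
    where
      finish : ∀ σ → + price σ small * F + F * (+ 2 * ν + + final (next σ small)) + + price σ medium * F * ν
                     + ν * closed (next σ medium) ν (+ 1) (+ 0) F
                       ≡ closed σ (+ 1 + ν) (+ 1) (+ 0) ((+ 1 + ν) * F)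
      finish left  = finish-small-left F ν
      finish right = finish-small-right F ν

  isolate-large : ∀ F ν A B C ps pm pl →
    (+ 0 + + 1) * ((ps * F + A) * + 0 + (pm * F + B) * ν + (pl * F + C) * + 1)
      ≡ pl * F + C + pm * F * ν + ν * ((+ 0 + + 1) * B)
  isolate-large = solve-∀

  finish-large-left : ∀ F ν →
    + 1 * F + F * (+ 2 * ν + + 2) + + 2 * F * ν
    + ν * (F * ((+ 2 * ν + + 1) * (+ 0 + + 1) - + 2 * + 0 * + 1))
      ≡ ((+ 1 + ν) * F) * ((+ 2 * (+ 1 + ν) + + 1) * (+ 0 + + 1) - + 2 * + 0 * + 1)
  finish-large-left = solve-∀

  finish-large-right : ∀ F ν →
    + 2 * F + F * (+ 2 * ν + + 2) + + 2 * F * ν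
    + ν * (F * (+ 2 * ν * (+ 0 + + 1) + + 2 * + 1 - + 2 * + 0 * + 1))
      ≡ ((+ 1 + ν) * F) * (+ 2 * (+ 1 + ν) * (+ 0 + + 1) + + 2 * + 1 - + 2 * + 0 * + 1)
  finish-large-right = solve-∀

  single-large : ∀ σ F ν A B C → C ≡ F * (+ 2 * ν + + final (next σ large)) →
    ν * ((+ 0 + + 1) * B) ≡ ν * closed (next σ medium) ν (+ 0) (+ 1) F →
    (+ 0 + + 1) * ((+ price σ small * F + A) * + 0 + (+ price σ medium * F + B) * ν + (+ price σ large * F + C) * + 1)
      ≡ closed σ (+ 1 + ν) (+ 0) (+ 1) ((+ 1 + ν) * F)
  single-large σ F ν A B C refl hM =
    trans (isolate-large F ν A B C (+ price σ small) (+ price σ medium) (+ price σ large))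
          (trans (cong (λ x → + price σ large * F + C + + price σ medium * F * ν + x) hM) (finish σ))
    where
      finish : ∀ σ → + price σ large * F + F * (+ 2 * ν + + final (next σ large)) + + price σ medium * F * ν
                     + ν * closed (next σ medium) ν (+ 0) (+ 1) F
                       ≡ closed σ (+ 1 + ν) (+ 0) (+ 1) ((+ 1 + ν) * F)
      finish left  = finish-large-left F ν
      finish right = finish-large-right F ν

  ClosedForms : ℕ → Set
  ClosedForms N = ∀ s m l → s ℕ.+ m ℕ.+ l ≡ N → ∀ σ → ClosedFormAt N s m l σ

  after-small : ∀ N s m l → s ℕ.+ m ℕ.+ l ≡ suc N → ClosedForms N → ∀ σ →
    + s * ((+ s + + l - + 1) * + permCost σ N (s ∸ 1) m l) ≡ + s * closed σ (+ N) (+ s - + 1) (+ l) (+ (N !))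
  after-small N zero    m l total ih σ = refl
  after-small N (suc a) m l total ih σ = cong (+ suc a *_) (ih a m l (ℕ.suc-injective total) σ)

  after-medium : ∀ N s m l → s ℕ.+ m ℕ.+ l ≡ suc N → ClosedForms N → ∀ σ →
    + m * ((+ s + + l) * + permCost σ N s (m ∸ 1) l) ≡ + m * closed σ (+ N) (+ s) (+ l) (+ (N !))
  after-medium N s zero    l total ih σ = refl
  after-medium N s (suc c) l total ih σ =
    cong (+ suc c *_) (ih s c l (ℕ.suc-injective (trans (cong (ℕ._+ l) (sym (ℕ.+-suc s c))) total)) σ)

  after-large : ∀ N s m l → s ℕ.+ m ℕ.+ l ≡ suc N → ClosedForms N → ∀ σ →
    + l * ((+ s + + l - + 1) * + permCost σ N s m (l ∸ 1)) ≡ + l * closed σ (+ N) (+ s) (+ l - + 1) (+ (N !))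
  after-large N s m zero    total ih σ = refl
  after-large N s m (suc b) total ih σ =
    cong (+ suc b *_) (trans (cong (λ x → (+ x - + 1) * + permCost σ N s m b) (ℕ.+-suc s b))
                             (ih s m b (ℕ.suc-injective (trans (sym (ℕ.+-suc (s ℕ.+ m) b)) total)) σ))

  medium-count : ∀ N s m l → s ℕ.+ m ℕ.+ l ≡ suc N → + m ≡ + 1 + + N - + s - + l
  medium-count N s m l total =
    trans (solve-m (+ s) (+ m) (+ l))
          (cong (λ x → x - + s - + l) (trans (sym (trans (pos-+ (s ℕ.+ m) l) (cong (_+ + l) (pos-+ s m))))
                                             (cong +_ total)))
    where
      solve-m : ∀ S M L → M ≡ S + M + L - S - L
      solve-m = solve-∀

  two-extreme : ∀ s l → 2 ℕ.≤ s ℕ.+ l → + s + + l - + 1 ≢ + 0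
  two-extreme s l two k≡0 = ℕ.<⇒≢ two (sym (+-injective (trans (pos-+ s l) (x≡x-1+1 (+ s + + l) k≡0))))
    where
      x≡x-1+1 : ∀ X → X - + 1 ≡ + 0 → X ≡ + 1
      x≡x-1+1 X h = trans (solve-x X) (cong (_+ + 1) h)
        where solve-x : ∀ X → X ≡ X - + 1 + + 1
              solve-x = solve-∀

  factorial-suc : ∀ N → + (suc N !) ≡ (+ 1 + + N) * + (N !)
  factorial-suc N = pos-* (suc N) (N !)

  all-mediumℤ : ∀ σ N → + permCost σ N 0 N 0 ≡ + (N !) * (+ 2 * + N + + final σ)
  all-mediumℤ σ N =
    trans (cong +_ (all-medium σ N))
          (trans (pos-* (N !) _) (cong (+ (N !) *_) (cast-affine 2 N (final σ))))

  closed-step : ∀ N s m l → s ℕ.+ m ℕ.+ l ≡ suc N → 2 ℕ.≤ s ℕ.+ l → ClosedForms N → ∀ σ →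
    ClosedFormAt (suc N) s m l σ
  closed-step N s m l total two ih σ =
    trans (cong ((+ s + + l) *_) (permCost-sucℤ σ N s m l))
      (trans (step-algebra σ (medium-count N s m l total) (two-extreme s l two)
               (after-small N s m l total ih (next σ small))
               (after-medium N s m l total ih (next σ medium))
               (after-large N s m l total ih (next σ large)))
             (cong (closed σ (+ suc N) (+ s) (+ l)) (sym (factorial-suc N))))

  closed-one-small : ∀ N → ClosedForms N → ∀ σ → ClosedFormAt (suc N) 1 N 0 σ
  closed-one-small N ih σ =
    trans (cong ((+ 1 + + 0) *_) (permCost-sucℤ σ N 1 N 0))
      (trans (single-small σ (+ (N !)) (+ N) _ _ _ (all-mediumℤ (next σ small) N)
                           (after-medium N 1 N 0 (cong suc (ℕ.+-identityʳ N)) ih (next σ medium)))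
             (cong (closed σ (+ suc N) (+ 1) (+ 0)) (sym (factorial-suc N))))

  closed-one-large : ∀ N → ClosedForms N → ∀ σ → ClosedFormAt (suc N) 0 N 1 σ
  closed-one-large N ih σ =
    trans (cong ((+ 0 + + 1) *_) (permCost-sucℤ σ N 0 N 1))
      (trans (single-large σ (+ (N !)) (+ N) _ _ _ (all-mediumℤ (next σ large) N)
                           (after-medium N 0 N 1 (ℕ.+-comm N 1) ih (next σ medium)))
             (cong (closed σ (+ suc N) (+ 0) (+ 1)) (sym (factorial-suc N))))

  closed-form : ∀ N → ClosedForms N
  closed-form zero zero zero zero refl σ = closed-none σ (+ 0) (+ 1)
  closed-form (suc N) zero m zero total σ = closed-none σ (+ suc N) (+ (suc N !))
  closed-form (suc N) (suc zero) m zero total σ with ℕ.suc-injective (trans (sym (ℕ.+-identityʳ (suc m))) total)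
  ... | refl = closed-one-small N (closed-form N) σ
  closed-form (suc N) zero m (suc zero) total σ with ℕ.suc-injective (trans (ℕ.+-comm 1 m) total)
  ... | refl = closed-one-large N (closed-form N) σ
  closed-form (suc N) s@(suc (suc _)) m l total σ = closed-step N s m l total (ℕ.s≤s (ℕ.s≤s ℕ.z≤n)) (closed-form N) σ
  closed-form (suc N) s@(suc zero) m l@(suc _) total σ = closed-step N s m l total (ℕ.s≤s (ℕ.s≤s ℕ.z≤n)) (closed-form N) σ
  closed-form (suc N) s@zero m l@(suc (suc _)) total σ = closed-step N s m l total (ℕ.s≤s (ℕ.s≤s ℕ.z≤n)) (closed-form N) σ

  closed-left : ∀ N s m l → s ℕ.+ m ℕ.+ l ≡ N →
    (s ℕ.+ l) ℕ.* permCost left N s m l ℕ.+ 2 ℕ.* N ! ℕ.* s ℕ.* l ≡ N ! ℕ.* (2 ℕ.* N ℕ.+ 1) ℕ.* (s ℕ.+ l)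
  closed-left N s m l total = +-injective (
    begin
      + ((s ℕ.+ l) ℕ.* P ℕ.+ 2 ℕ.* F ℕ.* s ℕ.* l)
    ≡⟨ cast-lhs ⟩
      (+ s + + l) * + P + + 2 * + F * + s * + l
    ≡⟨ cong (_+ + 2 * + F * + s * + l) (closed-form N s m l total left) ⟩
      closed left (+ N) (+ s) (+ l) (+ F) + + 2 * + F * + s * + l
    ≡⟨ cancel-left (+ s) (+ l) (+ F) (+ N) ⟩
      + F * (+ 2 * + N + + 1) * (+ s + + l)
    ≡⟨ cast-rhs ⟨
      + (F ℕ.* (2 ℕ.* N ℕ.+ 1) ℕ.* (s ℕ.+ l))
    ∎)
    where
      open ≡-Reasoning
      F P : ℕ
      F = N !
      P = permCost left N s m l
      cancel-left : ∀ S L F ν →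
        F * ((+ 2 * ν + + 1) * (S + L) - + 2 * S * L) + + 2 * F * S * L ≡ F * (+ 2 * ν + + 1) * (S + L)
      cancel-left = solve-∀
      cast-lhs : + ((s ℕ.+ l) ℕ.* P ℕ.+ 2 ℕ.* F ℕ.* s ℕ.* l) ≡ (+ s + + l) * + P + + 2 * + F * + s * + l
      cast-lhs = trans (pos-+ ((s ℕ.+ l) ℕ.* P) (2 ℕ.* F ℕ.* s ℕ.* l))
                       (cong₂ _+_ (trans (pos-* (s ℕ.+ l) P) (cong (_* + P) (pos-+ s l)))
                                  (trans (pos-* (2 ℕ.* F ℕ.* s) l)
                                         (cong (_* + l) (trans (pos-* (2 ℕ.* F) s) (cong (_* + s) (pos-* 2 F))))))
      cast-rhs : + (F ℕ.* (2 ℕ.* N ℕ.+ 1) ℕ.* (s ℕ.+ l)) ≡ + F * (+ 2 * + N + + 1) * (+ s + + l)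
      cast-rhs = trans (pos-* (F ℕ.* (2 ℕ.* N ℕ.+ 1)) (s ℕ.+ l))
                       (cong₂ _*_ (trans (pos-* F (2 ℕ.* N ℕ.+ 1)) (cong (+ F *_) (cast-affine 2 N 1)))
                                  (pos-+ s l))

module RangeSums where

  open import Defs using (oneTo)
  open Sums using (Σ; Σ-map)
  open import Data.Nat
  open import Data.Nat.Properties
  open import Function using (_∘_)
  open import Relation.Binary.PropositionalEquality
  open import Algebra.Properties.CommutativeSemigroup +-commutativeSemigroup using (interchange)
  open import Data.Nat.Tactic.RingSolver using (solve-∀)

  Σ< : (ℕ → ℕ) → ℕ → ℕ
  Σ< f zero    = 0
  Σ< f (suc k) = Σ< f k + f k

  Σ<-cong : ∀ {f g} k → (∀ i → i < k → f i ≡ g i) → Σ< f k ≡ Σ< g k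
  Σ<-cong zero    f≗g = refl
  Σ<-cong (suc k) f≗g = cong₂ _+_ (Σ<-cong k (λ i i<k → f≗g i (m≤n⇒m≤1+n i<k))) (f≗g k ≤-refl)

  Σ<-+ : ∀ f g k → Σ< (λ i → f i + g i) k ≡ Σ< f k + Σ< g k
  Σ<-+ f g zero    = refl
  Σ<-+ f g (suc k) = trans (cong (_+ (f k + g k)) (Σ<-+ f g k)) (interchange (Σ< f k) (Σ< g k) (f k) (g k))

  Σ<-* : ∀ c f k → Σ< (λ i → c * f i) k ≡ c * Σ< f k
  Σ<-* c f zero    = sym (*-zeroʳ c)
  Σ<-* c f (suc k) = trans (cong (_+ c * f k) (Σ<-* c f k)) (sym (*-distribˡ-+ c (Σ< f k) (f k)))

  Σ<-const : ∀ c k → Σ< (λ _ → c) k ≡ k * c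
  Σ<-const c zero    = refl
  Σ<-const c (suc k) = trans (cong (_+ c) (Σ<-const c k)) (+-comm (k * c) c)

  Σ<-first : ∀ f k → Σ< f (suc k) ≡ f 0 + Σ< (f ∘ suc) k
  Σ<-first f zero    = +-comm 0 (f 0)
  Σ<-first f (suc k) = trans (cong (_+ f (suc k)) (Σ<-first f k)) (+-assoc (f 0) _ _)

  Σ-oneTo-suc : ∀ n f → Σ f (oneTo (suc n)) ≡ f 1 + Σ (f ∘ suc) (oneTo n)
  Σ-oneTo-suc n f = cong (f 1 +_) (Σ-map f suc (oneTo n))

  Σ-oneTo : ∀ n f → Σ f (oneTo n) ≡ Σ< (f ∘ suc) n
  Σ-oneTo zero    f = refl
  Σ-oneTo (suc n) f =
    trans (Σ-oneTo-suc n f) (trans (cong (f 1 +_) (Σ-oneTo n (f ∘ suc))) (sym (Σ<-first (f ∘ suc) n)))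

  Σ<-symmetric : ∀ (W : ℕ → ℕ → ℕ) → (∀ a b → W a b ≡ W b a) → (∀ a → W a a ≡ 0) → ∀ k →
    Σ< (λ a → Σ< (W a) k) k ≡ 2 * Σ< (λ b → Σ< (λ a → W a b) b) k
  Σ<-symmetric W sym-W diag-W zero    = refl
  Σ<-symmetric W sym-W diag-W (suc k) =
    begin
      Σ< (λ a → Σ< (W a) k + W a k) (suc k)
    ≡⟨ Σ<-+ (λ a → Σ< (W a) k) (λ a → W a k) (suc k) ⟩
      (Σ< (λ a → Σ< (W a) k) k + Σ< (W k) k) + (Σ< (λ a → W a k) k + W k k)
    ≡⟨ cong₂ (λ u v → (Σ< (λ a → Σ< (W a) k) k + u) + (Σ< (λ a → W a k) k + v))
             (Σ<-cong k (λ b _ → sym-W k b)) (diag-W k) ⟩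
      (Σ< (λ a → Σ< (W a) k) k + column) + (column + 0)
    ≡⟨ cong (λ x → (x + column) + (column + 0)) (Σ<-symmetric W sym-W diag-W k) ⟩
      (2 * triangle + column) + (column + 0)
    ≡⟨ twice triangle column ⟩
      2 * (triangle + column)
    ∎
    where
      open ≡-Reasoning
      column triangle : ℕ
      column = Σ< (λ a → W a k) k
      triangle = Σ< (λ b → Σ< (λ a → W a b) b) k
      twice : ∀ x y → (2 * x + y) + (y + 0) ≡ 2 * (x + y)
      twice = solve-∀

  -- Regrouping the pairs a < b < k by their difference b − a = k − j.
  Σ<-by-gap : ∀ (W : ℕ → ℕ → ℕ) k →
    Σ< (λ b → Σ< (λ a → W a b) b) k ≡ Σ< (λ j → Σ< (λ s → W s (s + (k ∸ j))) j) k
  Σ<-by-gap W zero    = refl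
  Σ<-by-gap W (suc k) =
    begin
      Σ< (λ b → Σ< (λ a → W a b) b) k + Σ< (λ a → W a k) k
    ≡⟨ cong₂ _+_ (Σ<-by-gap W k) (Σ<-cong k (λ j j<k → cong (W j) (sym (m+[n∸m]≡n (<⇒≤ j<k))))) ⟩
      Σ< (λ j → Σ< (λ s → W s (s + (k ∸ j))) j) k + Σ< (λ j → W j (j + (k ∸ j))) k
    ≡⟨ Σ<-+ (λ j → Σ< (λ s → W s (s + (k ∸ j))) j) (λ j → W j (j + (k ∸ j))) k ⟨
      Σ< (λ j → Σ< (λ s → W s (s + (suc k ∸ suc j))) (suc j)) k
    ≡⟨ Σ<-first (λ j → Σ< (λ s → W s (s + (suc k ∸ j))) j) k ⟨
      Σ< (λ j → Σ< (λ s → W s (s + (suc k ∸ j))) j) (suc k)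
    ∎
    where open ≡-Reasoning

module PivotPairs where

  open import Defs
  open Prelim
  open FirstStep
  open Sums
  open Counting
  open RangeSums using (Σ-oneTo-suc)
  open import Data.Bool using (Bool; if_then_else_)
  open import Data.Nat
  open import Data.Nat.Properties
  open import Data.List using (List; []; _∷_; _∷ʳ_; map; length)
  open import Data.List.Properties using (length-map)
  open import Data.Empty using (⊥-elim)
  open import Function using (_∘_)
  open import Data.Product using (_×_; _,_; proj₁; proj₂; uncurry)
  open import Relation.Binary using (tri<; tri≈; tri>)
  open import Relation.Binary.PropositionalEquality

  ⟦_⟧ : Bool → ℕ
  ⟦ b ⟧ = if b then 1 else 0

  Σ-zero : ∀ (xs : List ℕ) → Σ (λ _ → 0) xs ≡ 0
  Σ-zero []       = refl
  Σ-zero (x ∷ xs) = Σ-zero xs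

  length-oneTo : ∀ n → length (oneTo n) ≡ n
  length-oneTo zero    = refl
  length-oneTo (suc n) = cong suc (trans (length-map suc (oneTo n)) (length-oneTo n))

  count-below : ∀ n p → p ≤ suc n → Σ (λ x → ⟦ x <ᵇ p ⟧) (oneTo n) ≡ p ∸ 1
  count-below zero    zero          _         = refl
  count-below zero    (suc zero)    _         = refl
  count-below zero    (suc (suc p)) (s≤s ())
  count-below (suc n) zero          _         = trans (Σ-oneTo-suc n (λ x → ⟦ x <ᵇ 0 ⟧)) (Σ-zero (oneTo n))
  count-below (suc n) (suc zero)    _         = trans (Σ-oneTo-suc n (λ x → ⟦ x <ᵇ 1 ⟧)) (Σ-zero (oneTo n))
  count-below (suc n) (suc (suc p)) (s≤s p≤n) =
    trans (Σ-oneTo-suc n (λ x → ⟦ x <ᵇ suc (suc p) ⟧)) (cong suc (count-below n (suc p) p≤n))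

  count-above : ∀ n q → Σ (λ x → ⟦ q <ᵇ x ⟧) (oneTo n) ≡ n ∸ q
  count-above zero    zero    = refl
  count-above zero    (suc q) = refl
  count-above (suc n) zero    =
    trans (Σ-oneTo-suc n (λ x → ⟦ 0 <ᵇ x ⟧))
          (cong suc (trans (Σ-const 1 (oneTo n)) (trans (*-identityˡ _) (length-oneTo n))))
  count-above (suc n) (suc q) = trans (Σ-oneTo-suc n (λ x → ⟦ suc q <ᵇ x ⟧)) (count-above n q)

  never-zero : ∀ n → Σ (λ x → ⟦ x ≡ᵇ 0 ⟧) (oneTo n) ≡ 0
  never-zero zero    = refl
  never-zero (suc n) = trans (Σ-oneTo-suc n (λ x → ⟦ x ≡ᵇ 0 ⟧)) (Σ-zero (oneTo n))

  count-equal : ∀ n c → Σ (λ x → ⟦ x ≡ᵇ c ⟧) (oneTo n) ≤ 1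
  count-equal zero    c             = z≤n
  count-equal (suc n) zero          = ≤-trans (≤-reflexive (never-zero (suc n))) z≤n
  count-equal (suc n) (suc zero)    =
    ≤-reflexive (trans (Σ-oneTo-suc n (λ x → ⟦ x ≡ᵇ 1 ⟧)) (cong suc (never-zero n)))
  count-equal (suc n) (suc (suc c)) =
    ≤-trans (≤-reflexive (Σ-oneTo-suc n (λ x → ⟦ x ≡ᵇ suc (suc c) ⟧))) (count-equal n (suc c))

  splits-bound : ∀ n {y r} → Splits (oneTo n) y r → y ≤ n
  splits-bound n {y} {r} s = ≮⇒≥ λ n<y → 0≢1+n (
    begin
      0
    ≡⟨ n∸n≡0 n ⟨
      n ∸ n
    ≡⟨ count-above n n ⟨
      Σ (λ x → ⟦ n <ᵇ x ⟧) (oneTo n)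
    ≡⟨ Splits.sums s (λ x → ⟦ n <ᵇ x ⟧) ⟩
      ⟦ n <ᵇ y ⟧ + Σ (λ x → ⟦ n <ᵇ x ⟧) r
    ≡⟨ cong (λ b → ⟦ b ⟧ + Σ (λ x → ⟦ n <ᵇ x ⟧) r) (<ᵇ-true n<y) ⟩
      suc (Σ (λ x → ⟦ n <ᵇ x ⟧) r)
    ∎)
    where open ≡-Reasoning

  splits-distinct : ∀ n {a r b r′} → Splits (oneTo n) a r → Splits r b r′ → a ≢ b
  splits-distinct n {a} {r} {b} {r′} sa sb refl =
    1+n≰n (≤-trans (s≤s (s≤s z≤n)) (≤-trans (≤-reflexive (sym twice)) (count-equal n a)))
    where
      indicator : ℕ → ℕ
      indicator x = ⟦ x ≡ᵇ a ⟧
      twice : Σ indicator (oneTo n) ≡ suc (suc (Σ indicator r′))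
      twice rewrite Splits.sums sa indicator | Splits.sums sb indicator | ≡ᵇ-refl a = refl

  -- For end values a ≠ b of a permutation of 1, …, N+2 the inner elements
  -- are the other N values: p − 1 small, N + 2 − q large and the rest medium,
  -- so the summed cost only depends on the pivots p < q.
  pivotCost : ℕ → ℕ → ℕ → ℕ
  pivotCost N p q = N ! + permCost left N (p ∸ 1) (N ∸ (p ∸ 1) ∸ (2 + N ∸ q)) (2 + N ∸ q)

  -- The summed cost for the end values a, b (the case a = b does not occur).
  pairCost : ℕ → ℕ → ℕ → ℕ
  pairCost N a b = if a ≡ᵇ b then 0 else pivotCost N (lowPivot a b) (highPivot a b)

  pairCost-diagonal : ∀ N a → pairCost N a a ≡ 0
  pairCost-diagonal N a rewrite ≡ᵇ-refl a = refl

  medium-rest : ∀ s m l N → s + m + l ≡ N → m ≡ N ∸ s ∸ l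
  medium-rest s m l N total =
    begin
      m
    ≡⟨ m+n∸n≡m m l ⟨
      m + l ∸ l
    ≡⟨ cong (_∸ l) (m+n∸m≡n s (m + l)) ⟨
      s + (m + l) ∸ s ∸ l
    ≡⟨ cong (λ x → x ∸ s ∸ l) (trans (sym (+-assoc s m l)) total) ⟩
      N ∸ s ∸ l
    ∎
    where open ≡-Reasoning

  module EndValues (N a b : ℕ) {r r′ : List ℕ}
                   (sa : Splits (oneTo (2 + N)) a r) (sb : Splits r b r′) where
    n p q : ℕ
    n = 2 + N
    p = lowPivot a b
    q = highPivot a b
    open Classify p q (lowPivot≤highPivot a b)

    both : ∀ f → Σ f (oneTo n) ≡ f a + (f b + Σ f r′)
    both f = trans (Splits.sums sa f) (cong (f a +_) (Splits.sums sb f))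

    length-rest : length r′ ≡ N
    length-rest = suc-injective (suc-injective (
      trans (sym (cong suc (length-splits sb))) (trans (sym (length-splits sa)) (length-oneTo n))))

    -- a and b are medium, so r′ has as many small and large elements as 1, …, n
    same-count : ∀ c → ind c medium ≡ 0 → count c r′ ≡ count c (oneTo n)
    same-count c zero-medium = sym (
      trans (both (λ x → ind c (class x)))
            (cong₂ _+_ (trans (cong (ind c) (medium-class a (lowPivot≤a a b) (a≤highPivot a b))) zero-medium)
                       (cong (_+ count c r′)
                             (trans (cong (ind c) (medium-class b (lowPivot≤b a b) (b≤highPivot a b))) zero-medium))))

    smalls : count small r′ ≡ p ∸ 1
    smalls = trans (same-count small refl)
                   (trans (Σ-cong small-indicator (oneTo n))
                          (count-below n p (≤-trans (lowPivot≤a a b) (m≤n⇒m≤1+n (splits-bound n sa)))))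

    larges : count large r′ ≡ n ∸ q
    larges = trans (same-count large refl) (trans (Σ-cong large-indicator (oneTo n)) (count-above n q))

    mediums : count medium r′ ≡ N ∸ (p ∸ 1) ∸ (n ∸ q)
    mediums = trans (medium-rest (count small r′) (count medium r′) (count large r′) N (trans (count-total r′) length-rest))
                    (cong₂ (λ u v → N ∸ u ∸ v) smalls larges)

    cost : Σperm (λ π → firstPartitionComparisons (a ∷ (π ∷ʳ b))) r′ ≡ pairCost N a b
    cost rewrite ≡ᵇ-false (splits-distinct n sa sb) =
      begin
        Σperm (λ π → firstPartitionComparisons (a ∷ (π ∷ʳ b))) r′
      ≡⟨ Σperm-cong (firstPartition-inner a b) r′ ⟩
        Σperm (λ π → 1 + inner left π) r′
      ≡⟨ Σperm-shift N r′ 1 (inner left) length-rest ⟩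
        1 * N ! + Σperm (inner left) r′
      ≡⟨ cong₂ _+_ (*-identityˡ (N !)) (Σperm-inner left N r′ length-rest) ⟩
        N ! + permCost left N (count small r′) (count medium r′) (count large r′)
      ≡⟨ cong (λ (u , v , w) → N ! + permCost left N u v w) (cong₂ _,_ smalls (cong₂ _,_ mediums larges)) ⟩
        pivotCost N p q
      ∎
      where open ≡-Reasoning

  Σperm-pairs : ∀ N →
    Σperm firstPartitionComparisons (oneTo (2 + N)) ≡ Σ (λ a → Σ (pairCost N a) (oneTo (2 + N))) (oneTo (2 + N))
  Σperm-pairs N =
    trans (Σperm-first firstPartitionComparisons 1 (map suc (oneTo (suc N))))
          (Σ-select X _ (λ a → Σ (pairCost N a) X) first-end)
    where
      X : List ℕ
      X = oneTo (2 + N)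
      first-end : ∀ a r → Splits X a r → Σperm (firstPartitionComparisons ∘ (a ∷_)) r ≡ Σ (pairCost N a) X
      first-end a []       sa = ⊥-elim (0≢1+n (suc-injective (trans (sym (length-splits sa)) (length-oneTo (2 + N)))))
      first-end a (x ∷ xs) sa =
        begin
          Σperm (firstPartitionComparisons ∘ (a ∷_)) (x ∷ xs)
        ≡⟨ Σperm-last (firstPartitionComparisons ∘ (a ∷_)) x xs ⟩
          Σ (uncurry λ b r′ → Σperm (λ π → firstPartitionComparisons (a ∷ (π ∷ʳ b))) r′) (select (x ∷ xs))
        ≡⟨ Σ-select (x ∷ xs) _ (pairCost N a) (λ b r′ sb → EndValues.cost N a b sa sb) ⟩
          Σ (pairCost N a) (x ∷ xs)
        ≡⟨ cong (_+ Σ (pairCost N a) (x ∷ xs)) (pairCost-diagonal N a) ⟨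
          pairCost N a a + Σ (pairCost N a) (x ∷ xs)
        ≡⟨ Splits.sums sa (pairCost N a) ⟨
          Σ (pairCost N a) X
        ∎
        where open ≡-Reasoning

  pivots-ordered : ∀ {a b} → a < b → lowPivot a b ≡ a × highPivot a b ≡ b
  pivots-ordered {a} {b} a<b rewrite <ᵇ-false {b} {a} (<⇒≤ a<b) = refl , refl

  pivots-reversed : ∀ {a b} → b < a → lowPivot a b ≡ b × highPivot a b ≡ a
  pivots-reversed {a} {b} b<a rewrite <ᵇ-true b<a = refl , refl

  pairCost-symmetric : ∀ N a b → pairCost N a b ≡ pairCost N b a
  pairCost-symmetric N a b with <-cmp a b
  ... | tri< a<b _ _ rewrite ≡ᵇ-false (<⇒≢ a<b) | ≡ᵇ-false (>⇒≢ a<b) =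
    cong₂ (pivotCost N) (trans (proj₁ (pivots-ordered a<b)) (sym (proj₁ (pivots-reversed a<b))))
                          (trans (proj₂ (pivots-ordered a<b)) (sym (proj₂ (pivots-reversed a<b))))
  ... | tri≈ _ refl _ = refl
  ... | tri> _ _ b<a rewrite ≡ᵇ-false (>⇒≢ b<a) | ≡ᵇ-false (<⇒≢ b<a) =
    cong₂ (pivotCost N) (trans (proj₁ (pivots-reversed b<a)) (sym (proj₁ (pivots-ordered b<a))))
                          (trans (proj₂ (pivots-reversed b<a)) (sym (proj₂ (pivots-ordered b<a))))

module Summation where

  open import Defs
  open Prelim
  open Sums using (Σ; Σperm)
  open Counting using (left; permCost)
  open ClosedForm using (closed-left; all-medium)
  open PivotPairs
  open RangeSums
  open import Data.Nat
  open import Data.Nat.Properties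
  open import Data.Product using (_,_; proj₁; proj₂)
  open import Relation.Binary.PropositionalEquality
  open import Data.Nat.Tactic.RingSolver using (solve-∀)

  Σ-ids : ∀ t → 2 * Σ< (λ s → s) (suc t) ≡ t * suc t
  Σ-ids zero    = refl
  Σ-ids (suc t) =
    trans (*-distribˡ-+ 2 (Σ< (λ s → s) (suc t)) (suc t))
          (trans (cong (_+ 2 * suc t) (Σ-ids t)) (step t))
    where
      step : ∀ t → t * suc t + 2 * suc t ≡ suc t * suc (suc t)
      step = solve-∀

  Σ-products : ∀ t → 6 * Σ< (λ s → s * (t ∸ s)) (suc t) + t ≡ t * t * t
  Σ-products zero    = refl
  Σ-products (suc t) =
    begin
      6 * (Σ< (λ s → s * (suc t ∸ s)) (suc t) + suc t * (suc t ∸ suc t)) + suc t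
    ≡⟨ cong₂ (λ u w → 6 * (u + suc t * w) + suc t) (Σ<-cong (suc t) one-more) (n∸n≡0 t) ⟩
      6 * (Σ< (λ s → s + s * (t ∸ s)) (suc t) + suc t * 0) + suc t
    ≡⟨ cong (λ u → 6 * (u + suc t * 0) + suc t) (Σ<-+ (λ s → s) (λ s → s * (t ∸ s)) (suc t)) ⟩
      6 * (Σ< (λ s → s) (suc t) + Σ< (λ s → s * (t ∸ s)) (suc t) + suc t * 0) + suc t
    ≡⟨ regroup (Σ< (λ s → s) (suc t)) (Σ< (λ s → s * (t ∸ s)) (suc t)) t ⟩
      3 * (2 * Σ< (λ s → s) (suc t)) + (6 * Σ< (λ s → s * (t ∸ s)) (suc t) + t) + 1
    ≡⟨ cong₂ (λ u w → 3 * u + w + 1) (Σ-ids t) (Σ-products t) ⟩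
      3 * (t * suc t) + t * t * t + 1
    ≡⟨ cube t ⟩
      suc t * suc t * suc t
    ∎
    where
      open ≡-Reasoning
      one-more : ∀ s → s < suc t → s * (suc t ∸ s) ≡ s + s * (t ∸ s)
      one-more s s<1+t = trans (cong (s *_) (+-∸-assoc 1 (≤-pred s<1+t))) (*-suc s (t ∸ s))
      regroup : ∀ b a t → 6 * (b + a + suc t * 0) + suc t ≡ 3 * (2 * b) + (6 * a + t) + 1
      regroup = solve-∀
      cube : ∀ t → 3 * (t * suc t) + t * t * t + 1 ≡ suc t * suc t * suc t
      cube = solve-∀

  Σ-squares : ∀ N → 6 * Σ< (λ i → suc i * suc i) N ≡ N * suc N * (2 * N + 1)
  Σ-squares zero    = refl
  Σ-squares (suc N) =
    trans (*-distribˡ-+ 6 (Σ< (λ i → suc i * suc i) N) (suc N * suc N))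
          (trans (cong (_+ 6 * (suc N * suc N)) (Σ-squares N)) (step N))
    where
      step : ∀ N → N * suc N * (2 * N + 1) + 6 * (suc N * suc N) ≡ suc N * suc (suc N) * (2 * suc N + 1)
      step = solve-∀

  Σ-shifted : ∀ N → 2 * Σ< (λ i → i + 2) N ≡ N * (N + 3)
  Σ-shifted zero    = refl
  Σ-shifted (suc N) =
    trans (*-distribˡ-+ 2 (Σ< (λ i → i + 2) N) (N + 2))
          (trans (cong (_+ 2 * (N + 2)) (Σ-shifted N)) (step N))
    where
      step : ∀ N → N * (N + 3) + 2 * (N + 2) ≡ suc N * (suc N + 3)
      step = solve-∀

  top-gap : ∀ s u v → suc (s + u + v) ∸ (s + u) ≡ suc v
  top-gap s u v = trans (cong (_∸ (s + u)) (sym (+-suc (s + u) v))) (m+n∸m≡n (s + u) (suc v))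

  low-gap : ∀ s u v → suc (s + u + v) ∸ (s + suc v) ≡ u
  low-gap s u v = trans (cong (_∸ (s + suc v)) (rearrange s u v)) (m+n∸n≡m u (s + suc v))
    where
      rearrange : ∀ s u v → suc (s + u + v) ≡ u + (s + suc v)
      rearrange = solve-∀

  s<s+1+v : ∀ s v → suc s < suc (s + suc v)
  s<s+1+v s v = s≤s (m<m+n s z<s)

  -- The end values s+1 < b+1 with t = s + l extreme inner elements, where
  -- b = s + (N + 1 − t), contribute N! + permCost with s small, l = t − s
  -- large and N − t medium inner elements.
  gap-value : ∀ N t s → s ≤ t → t ≤ N →
    pairCost N (suc s) (suc (s + (suc N ∸ t))) ≡ N ! + permCost left N s (N ∸ t) (t ∸ s)
  gap-value N t s s≤t t≤N with m≤n⇒∃[o]m+o≡n s≤t | m≤n⇒∃[o]m+o≡n t≤N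
  ... | u , refl | v , refl
    rewrite top-gap s u v | ≡ᵇ-false (<⇒≢ (s<s+1+v s v)) | proj₁ (pivots-ordered (s<s+1+v s v))
          | proj₂ (pivots-ordered (s<s+1+v s v)) | low-gap s u v =
    cong₂ (λ x y → (s + u + v) ! + permCost left (s + u + v) s x y)
          (∸-+-assoc (s + u + v) s u) (sym (m+n∸m≡n s u))

  module Totals (N : ℕ) where
    F n : ℕ
    F = N !
    n = 2 + N

    -- The total cost over the end values with t extreme inner elements.
    gapCost : ℕ → ℕ
    gapCost t = Σ< (λ s → F + permCost left N s (N ∸ t) (t ∸ s)) (suc t)

    -- The total over all permutations, grouped by the number of extreme
    -- inner elements (each unordered pair of end values occurs twice).
    total-by-gaps : Σperm firstPartitionComparisons (oneTo n) ≡ 2 * Σ< gapCost (suc N)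
    total-by-gaps =
      begin
        Σperm firstPartitionComparisons (oneTo n)
      ≡⟨ Σperm-pairs N ⟩
        Σ (λ a → Σ (pairCost N a) (oneTo n)) (oneTo n)
      ≡⟨ Σ-oneTo n (λ a → Σ (pairCost N a) (oneTo n)) ⟩
        Σ< (λ a → Σ (pairCost N (suc a)) (oneTo n)) n
      ≡⟨ Σ<-cong n (λ a _ → Σ-oneTo n (pairCost N (suc a))) ⟩
        Σ< (λ a → Σ< (W a) n) n
      ≡⟨ Σ<-symmetric W (λ a b → pairCost-symmetric N (suc a) (suc b)) (λ a → pairCost-diagonal N (suc a)) n ⟩
        2 * Σ< (λ b → Σ< (λ a → W a b) b) n
      ≡⟨ cong (2 *_) (Σ<-by-gap W n) ⟩
        2 * Σ< (λ j → Σ< (λ s → W s (s + (n ∸ j))) j) n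
      ≡⟨ cong (2 *_) (Σ<-first (λ j → Σ< (λ s → W s (s + (n ∸ j))) j) (suc N)) ⟩
        2 * Σ< (λ t → Σ< (λ s → W s (s + (suc N ∸ t))) (suc t)) (suc N)
      ≡⟨ cong (2 *_) (Σ<-cong (suc N) λ t t<1+N →
                        Σ<-cong (suc t) λ s s<1+t → gap-value N t s (≤-pred s<1+t) (≤-pred t<1+N)) ⟩
        2 * Σ< gapCost (suc N)
      ∎
      where
        open ≡-Reasoning
        W : ℕ → ℕ → ℕ
        W a b = pairCost N (suc a) (suc b)

    gapCost-zero : gapCost 0 ≡ F + F * (2 * N + 1)
    gapCost-zero = cong (F +_) (all-medium left N)

    gapCost-weighted : ∀ t → t ≤ N →
      t * gapCost t + 2 * F * Σ< (λ s → s * (t ∸ s)) (suc t) ≡ suc t * (t * (F * (2 * N + 2)))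
    gapCost-weighted t t≤N =
      begin
        t * gapCost t + 2 * F * Σ< (λ s → s * (t ∸ s)) (suc t)
      ≡⟨ cong₂ _+_ (Σ<-* t _ (suc t)) (Σ<-* (2 * F) (λ s → s * (t ∸ s)) (suc t)) ⟨
        Σ< (λ s → t * (F + permCost left N s (N ∸ t) (t ∸ s))) (suc t) + Σ< (λ s → 2 * F * (s * (t ∸ s))) (suc t)
      ≡⟨ Σ<-+ _ _ (suc t) ⟨
        Σ< (λ s → t * (F + permCost left N s (N ∸ t) (t ∸ s)) + 2 * F * (s * (t ∸ s))) (suc t)
      ≡⟨ Σ<-cong (suc t) (λ s s<1+t → term s (≤-pred s<1+t)) ⟩
        Σ< (λ _ → t * (F * (2 * N + 2))) (suc t)
      ≡⟨ Σ<-const (t * (F * (2 * N + 2))) (suc t) ⟩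
        suc t * (t * (F * (2 * N + 2)))
      ∎
      where
        open ≡-Reasoning
        term : ∀ s → s ≤ t → t * (F + permCost left N s (N ∸ t) (t ∸ s)) + 2 * F * (s * (t ∸ s)) ≡ t * (F * (2 * N + 2))
        term s s≤t =
          begin
            t * (F + P) + 2 * F * (s * (t ∸ s))
          ≡⟨ rearrange t F P s (t ∸ s) ⟩
            t * F + (t * P + 2 * F * s * (t ∸ s))
          ≡⟨ cong (λ x → t * F + (x * P + 2 * F * s * (t ∸ s))) s+[t-s]≡t ⟨
            t * F + ((s + (t ∸ s)) * P + 2 * F * s * (t ∸ s))
          ≡⟨ cong (t * F +_) (closed-left N s (N ∸ t) (t ∸ s) composition) ⟩
            t * F + F * (2 * N + 1) * (s + (t ∸ s))
          ≡⟨ cong (λ x → t * F + F * (2 * N + 1) * x) s+[t-s]≡t ⟩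
            t * F + F * (2 * N + 1) * t
          ≡⟨ collect t F N ⟩
            t * (F * (2 * N + 2))
          ∎
          where
            P : ℕ
            P = permCost left N s (N ∸ t) (t ∸ s)
            s+[t-s]≡t : s + (t ∸ s) ≡ t
            s+[t-s]≡t = m+[n∸m]≡n s≤t
            composition : s + (N ∸ t) + (t ∸ s) ≡ N
            composition = trans (+-assoc s (N ∸ t) (t ∸ s))
                            (trans (cong (s +_) (+-comm (N ∸ t) (t ∸ s)))
                              (trans (sym (+-assoc s (t ∸ s) (N ∸ t)))
                                (trans (cong (_+ (N ∸ t)) s+[t-s]≡t) (m+[n∸m]≡n t≤N))))
            rearrange : ∀ t F P s d → t * (F + P) + 2 * F * (s * d) ≡ t * F + (t * P + 2 * F * s * d)
            rearrange = solve-∀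
            collect : ∀ t F N → t * F + F * (2 * N + 1) * t ≡ t * (F * (2 * N + 2))
            collect = solve-∀

    -- Dividing by t ≥ 1, using  6 Σ_{s≤t} s(t−s) + t = t³.
    gapCost-value : ∀ i → suc i ≤ N →
      3 * gapCost (suc i) + F * (suc i * suc i) ≡ 3 * F * (2 * N + 2) * (i + 2) + F
    gapCost-value i t≤N =
      *-cancelˡ-≡ _ _ t (+-cancelʳ-≡ (3 * (2 * F * S)) _ _ (trans lhs (sym rhs)))
      where
        t S common : ℕ
        t = suc i
        S = Σ< (λ s → s * (t ∸ s)) (suc t)
        common = 3 * (suc t * (t * (F * (2 * N + 2)))) + F * (6 * S + t)
        lhs : t * (3 * gapCost t + F * (t * t)) + 3 * (2 * F * S) ≡ common
        lhs = trans (expand t (gapCost t) F S)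
                    (cong₂ (λ x y → 3 * x + F * y) (gapCost-weighted t t≤N) (sym (Σ-products t)))
          where expand : ∀ t G F S → t * (3 * G + F * (t * t)) + 3 * (2 * F * S) ≡ 3 * (t * G + 2 * F * S) + F * (t * t * t)
                expand = solve-∀
        rhs : t * (3 * F * (2 * N + 2) * (i + 2) + F) + 3 * (2 * F * S) ≡ common
        rhs = expand i F N S
          where expand : ∀ i F N S → suc i * (3 * F * (2 * N + 2) * (i + 2) + F) + 3 * (2 * F * S)
                                       ≡ 3 * (suc (suc i) * (suc i * (F * (2 * N + 2)))) + F * (6 * S + suc i)
                expand = solve-∀

    upper-gaps : 18 * Σ< (λ i → gapCost (suc i)) N + F * (N * suc N * (2 * N + 1))
                   ≡ 9 * F * (2 * N + 2) * (N * (N + 3)) + 6 * (N * F)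
    upper-gaps =
      begin
        18 * Γ + F * (N * suc N * (2 * N + 1))
      ≡⟨ cong (λ x → 18 * Γ + F * x) (Σ-squares N) ⟨
        18 * Γ + F * (6 * P)
      ≡⟨ six-times Γ F P ⟩
        6 * (3 * Γ + F * P)
      ≡⟨ cong (6 *_) summed ⟩
        6 * (3 * F * (2 * N + 2) * Q + N * F)
      ≡⟨ halve F N Q ⟩
        9 * F * (2 * N + 2) * (2 * Q) + 6 * (N * F)
      ≡⟨ cong (λ x → 9 * F * (2 * N + 2) * x + 6 * (N * F)) (Σ-shifted N) ⟩
        9 * F * (2 * N + 2) * (N * (N + 3)) + 6 * (N * F)
      ∎
      where
        open ≡-Reasoning
        Γ P Q : ℕ
        Γ = Σ< (λ i → gapCost (suc i)) N
        P = Σ< (λ i → suc i * suc i) N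
        Q = Σ< (λ i → i + 2) N
        summed : 3 * Γ + F * P ≡ 3 * F * (2 * N + 2) * Q + N * F
        summed =
          begin
            3 * Γ + F * P
          ≡⟨ cong₂ _+_ (Σ<-* 3 (λ i → gapCost (suc i)) N) (Σ<-* F (λ i → suc i * suc i) N) ⟨
            Σ< (λ i → 3 * gapCost (suc i)) N + Σ< (λ i → F * (suc i * suc i)) N
          ≡⟨ Σ<-+ (λ i → 3 * gapCost (suc i)) (λ i → F * (suc i * suc i)) N ⟨
            Σ< (λ i → 3 * gapCost (suc i) + F * (suc i * suc i)) N
          ≡⟨ Σ<-cong N (λ i i<N → gapCost-value i i<N) ⟩
            Σ< (λ i → 3 * F * (2 * N + 2) * (i + 2) + F) N
          ≡⟨ Σ<-+ (λ i → 3 * F * (2 * N + 2) * (i + 2)) (λ _ → F) N ⟩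
            Σ< (λ i → 3 * F * (2 * N + 2) * (i + 2)) N + Σ< (λ _ → F) N
          ≡⟨ cong₂ _+_ (Σ<-* (3 * F * (2 * N + 2)) (λ i → i + 2) N) (Σ<-const F N) ⟩
            3 * F * (2 * N + 2) * Q + N * F
          ∎
        six-times : ∀ Γ F P → 18 * Γ + F * (6 * P) ≡ 6 * (3 * Γ + F * P)
        six-times = solve-∀
        halve : ∀ F N Q → 6 * (3 * F * (2 * N + 2) * Q + N * F) ≡ 9 * F * (2 * N + 2) * (2 * Q) + 6 * (N * F)
        halve = solve-∀

    total-value : 9 * Σperm firstPartitionComparisons (oneTo n) + 27 * (n * (1 + N)) * F + 6 * F
                    ≡ 16 * (n + 1) * (n * (1 + N)) * F
    total-value = +-cancelʳ-≡ (F * (N * suc N * (2 * N + 1))) _ _ (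
      begin
        9 * Σperm firstPartitionComparisons (oneTo n) + 27 * (n * (1 + N)) * F + 6 * F + X
      ≡⟨ cong (λ x → 9 * x + 27 * (n * (1 + N)) * F + 6 * F + X)
              (trans total-by-gaps (cong (2 *_) (Σ<-first gapCost N))) ⟩
        9 * (2 * (gapCost 0 + Γ)) + 27 * (n * (1 + N)) * F + 6 * F + X
      ≡⟨ regroup (gapCost 0) Γ X F N ⟩
        18 * gapCost 0 + (18 * Γ + X) + 27 * (n * (1 + N)) * F + 6 * F
      ≡⟨ cong₂ (λ x y → 18 * x + y + 27 * (n * (1 + N)) * F + 6 * F) gapCost-zero upper-gaps ⟩
        18 * (F + F * (2 * N + 1)) + (9 * F * (2 * N + 2) * (N * (N + 3)) + 6 * (N * F))
          + 27 * (n * (1 + N)) * F + 6 * F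
      ≡⟨ evaluate F N ⟩
        16 * (n + 1) * (n * (1 + N)) * F + X
      ∎)
      where
        open ≡-Reasoning
        Γ X : ℕ
        Γ = Σ< (λ i → gapCost (suc i)) N
        X = F * (N * suc N * (2 * N + 1))
        regroup : ∀ G Γ X F N → 9 * (2 * (G + Γ)) + 27 * ((2 + N) * (1 + N)) * F + 6 * F + X
                                 ≡ 18 * G + (18 * Γ + X) + 27 * ((2 + N) * (1 + N)) * F + 6 * F
        regroup = solve-∀
        evaluate : ∀ F N → 18 * (F + F * (2 * N + 1)) + (9 * F * (2 * N + 2) * (N * (N + 3)) + 6 * (N * F))
                             + 27 * ((2 + N) * (1 + N)) * F + 6 * F
                             ≡ 16 * (2 + N + 1) * ((2 + N) * (1 + N)) * F + F * (N * suc N * (2 * N + 1))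
        evaluate = solve-∀

module Rationals where

  open import Data.Nat as ℕ using (ℕ; suc; NonZero)
  open import Data.Integer as ℤ using (ℤ; +_)
  open import Data.Rational using (ℚ; _/_; _+_; _*_; _-_; -_; toℚᵘ; fromℚᵘ; ↥_; ↧_)
  open import Data.Rational.Properties
    using (↥-/; ↧-/; ↥ᵘ-toℚᵘ; ↧ᵘ-toℚᵘ; fromℚᵘ-cong; fromℚᵘ-toℚᵘ; toℚᵘ-homo-+; toℚᵘ-homo-*; toℚᵘ-homo‿-)
  open import Data.Rational.Unnormalised as U using (ℚᵘ; _≃_; *≡*) renaming (↥_ to ↥ᵘ_; ↧_ to ↧ᵘ_)
  import Data.Rational.Unnormalised.Properties as U
  open import Data.Integer.GCD using (gcd)
  open import Data.Integer.Properties using (pos-+; pos-*)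
  open import Relation.Binary.PropositionalEquality
  open import Data.Integer.Tactic.RingSolver using (solve-∀)

  /-cross : ∀ a b d d′ .{{_ : NonZero d}} .{{_ : NonZero d′}} → a ℤ.* + d′ ≡ b ℤ.* + d → a / d ≡ b / d′
  /-cross a b (suc k) (suc k′) cross = fromℚᵘ-cong {U.mkℚᵘ a k} {U.mkℚᵘ b k′} (*≡* cross)

  toℚᵘ-/ : ∀ i d .{{_ : NonZero d}} → toℚᵘ (i / d) ≃ i U./ d
  toℚᵘ-/ i (suc k) = *≡* (
    begin
      ↥ᵘ (toℚᵘ p) ℤ.* + suc k
    ≡⟨ cong (ℤ._* + suc k) (↥ᵘ-toℚᵘ p) ⟩
      ↥ p ℤ.* + suc k
    ≡⟨ cong (↥ p ℤ.*_) (↧-/ i (suc k)) ⟨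
      ↥ p ℤ.* (↧ p ℤ.* g)
    ≡⟨ swap (↥ p) (↧ p) g ⟩
      ↥ p ℤ.* g ℤ.* ↧ p
    ≡⟨ cong (ℤ._* ↧ p) (↥-/ i (suc k)) ⟩
      i ℤ.* ↧ p
    ≡⟨ cong (i ℤ.*_) (↧ᵘ-toℚᵘ p) ⟨
      i ℤ.* ↧ᵘ (toℚᵘ p)
    ∎)
    where
      open ≡-Reasoning
      p : ℚ
      p = i / suc k
      g : ℤ
      g = gcd i (+ suc k)
      swap : ∀ a b c → a ℤ.* (b ℤ.* c) ≡ a ℤ.* c ℤ.* b
      swap = solve-∀

  toℚᵘ-shape : ∀ a b c d e {A B C D E} →
    toℚᵘ a ≃ A → toℚᵘ b ≃ B → toℚᵘ c ≃ C → toℚᵘ d ≃ D → toℚᵘ e ≃ E →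
    toℚᵘ ((a * b - c) - d * e) ≃ ((A U.* B U.- C) U.- D U.* E)
  toℚᵘ-shape a b c d e a≃ b≃ c≃ d≃ e≃ =
    U.≃-trans (minus (a * b - c) (d * e))
      (U.+-cong (U.≃-trans (minus (a * b) c) (U.+-cong (U.≃-trans (toℚᵘ-homo-* a b) (U.*-cong a≃ b≃)) (U.-‿cong c≃)))
                (U.-‿cong (U.≃-trans (toℚᵘ-homo-* d e) (U.*-cong d≃ e≃))))
    where
      minus : ∀ p q → toℚᵘ (p - q) ≃ (toℚᵘ p U.- toℚᵘ q)
      minus p q = U.≃-trans (toℚᵘ-homo-+ p (- q)) (U.+-cong (U.≃-refl {toℚᵘ p}) (toℚᵘ-homo‿- q))

  rhs-fraction : ∀ n k → ((+ 16 / 9) * (+ n / 1) - (+ 3 / 1)) - (+ 2 / 3) * (+ 1 / suc k)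
                           ≡ (+ 16 ℤ.* + n ℤ.* + suc k ℤ.- + 27 ℤ.* + suc k ℤ.- + 6) / (9 ℕ.* suc k)
  rhs-fraction n k =
    begin
      R
    ≡⟨ fromℚᵘ-toℚᵘ R ⟨
      fromℚᵘ (toℚᵘ R)
    ≡⟨ fromℚᵘ-cong (toℚᵘ-shape _ _ _ _ _ (toℚᵘ-/ (+ 16) 9) (toℚᵘ-/ (+ n) 1) (toℚᵘ-/ (+ 3) 1)
                                           (toℚᵘ-/ (+ 2) 3) (toℚᵘ-/ (+ 1) (suc k))) ⟩
      fromℚᵘ R′
    ≡⟨ /-cross (↥ᵘ R′) X (U.↧ₙ R′) (9 ℕ.* suc k) (cross (+ n) (+ suc k)) ⟩
      (+ 16 ℤ.* + n ℤ.* + suc k ℤ.- + 27 ℤ.* + suc k ℤ.- + 6) / (9 ℕ.* suc k)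
    ∎
    where
      open ≡-Reasoning
      R : ℚ
      R = ((+ 16 / 9) * (+ n / 1) - (+ 3 / 1)) - (+ 2 / 3) * (+ 1 / suc k)
      X : ℤ
      X = + 16 ℤ.* + n ℤ.* + suc k ℤ.- + 27 ℤ.* + suc k ℤ.- + 6
      R′ : ℚᵘ
      R′ = ((+ 16 U./ 9) U.* (+ n U./ 1) U.- (+ 3 U./ 1)) U.- (+ 2 U./ 3) U.* (+ 1 U./ suc k)
      cross : ∀ n K →
        ((+ 16 ℤ.* n ℤ.* + 1 ℤ.+ ℤ.- + 3 ℤ.* (+ 9 ℤ.* + 1)) ℤ.* (+ 3 ℤ.* K)
          ℤ.+ ℤ.- (+ 2 ℤ.* + 1) ℤ.* (+ 9 ℤ.* + 1 ℤ.* + 1)) ℤ.* (+ 9 ℤ.* K)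
        ≡ (+ 16 ℤ.* n ℤ.* K ℤ.- + 27 ℤ.* K ℤ.- + 6) ℤ.* (+ 9 ℤ.* + 1 ℤ.* + 1 ℤ.* (+ 3 ℤ.* K))
      cross = solve-∀

  fraction-identity : ∀ T K F B → 9 ℕ.* T ℕ.+ 27 ℕ.* K ℕ.* F ℕ.+ 6 ℕ.* F ≡ 16 ℕ.* B ℕ.* K ℕ.* F →
    + T ℤ.* + (9 ℕ.* K) ≡ (+ 16 ℤ.* + B ℤ.* + K ℤ.- + 27 ℤ.* + K ℤ.- + 6) ℤ.* + (K ℕ.* F)
  fraction-identity T K F B relation =
    begin
      + T ℤ.* + (9 ℕ.* K)
    ≡⟨ cong (+ T ℤ.*_) (pos-* 9 K) ⟩
      + T ℤ.* (+ 9 ℤ.* + K)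
    ≡⟨ isolate (+ T) (+ K) (+ F) ⟩
      + K ℤ.* (+ 9 ℤ.* + T ℤ.+ + 27 ℤ.* + K ℤ.* + F ℤ.+ + 6 ℤ.* + F) ℤ.- + K ℤ.* (+ 27 ℤ.* + K ℤ.* + F ℤ.+ + 6 ℤ.* + F)
    ≡⟨ cong (λ x → + K ℤ.* x ℤ.- + K ℤ.* (+ 27 ℤ.* + K ℤ.* + F ℤ.+ + 6 ℤ.* + F))
            (trans (sym cast-lhs) (trans (cong +_ relation) cast-rhs)) ⟩
      + K ℤ.* (+ 16 ℤ.* + B ℤ.* + K ℤ.* + F) ℤ.- + K ℤ.* (+ 27 ℤ.* + K ℤ.* + F ℤ.+ + 6 ℤ.* + F)
    ≡⟨ collect (+ B) (+ K) (+ F) ⟩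
      (+ 16 ℤ.* + B ℤ.* + K ℤ.- + 27 ℤ.* + K ℤ.- + 6) ℤ.* (+ K ℤ.* + F)
    ≡⟨ cong (X ℤ.*_) (pos-* K F) ⟨
      (+ 16 ℤ.* + B ℤ.* + K ℤ.- + 27 ℤ.* + K ℤ.- + 6) ℤ.* + (K ℕ.* F)
    ∎
    where
      open ≡-Reasoning
      X : ℤ
      X = + 16 ℤ.* + B ℤ.* + K ℤ.- + 27 ℤ.* + K ℤ.- + 6
      isolate : ∀ T K F → T ℤ.* (+ 9 ℤ.* K)
        ≡ K ℤ.* (+ 9 ℤ.* T ℤ.+ + 27 ℤ.* K ℤ.* F ℤ.+ + 6 ℤ.* F) ℤ.- K ℤ.* (+ 27 ℤ.* K ℤ.* F ℤ.+ + 6 ℤ.* F)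
      isolate = solve-∀
      collect : ∀ B K F → K ℤ.* (+ 16 ℤ.* B ℤ.* K ℤ.* F) ℤ.- K ℤ.* (+ 27 ℤ.* K ℤ.* F ℤ.+ + 6 ℤ.* F)
        ≡ (+ 16 ℤ.* B ℤ.* K ℤ.- + 27 ℤ.* K ℤ.- + 6) ℤ.* (K ℤ.* F)
      collect = solve-∀
      cast-lhs : + (9 ℕ.* T ℕ.+ 27 ℕ.* K ℕ.* F ℕ.+ 6 ℕ.* F) ≡ + 9 ℤ.* + T ℤ.+ + 27 ℤ.* + K ℤ.* + F ℤ.+ + 6 ℤ.* + F
      cast-lhs = trans (pos-+ (9 ℕ.* T ℕ.+ 27 ℕ.* K ℕ.* F) (6 ℕ.* F))
                   (cong₂ ℤ._+_ (trans (pos-+ (9 ℕ.* T) (27 ℕ.* K ℕ.* F))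
                                       (cong₂ ℤ._+_ (pos-* 9 T) (trans (pos-* (27 ℕ.* K) F) (cong (ℤ._* + F) (pos-* 27 K)))))
                                (pos-* 6 F))
      cast-rhs : + (16 ℕ.* B ℕ.* K ℕ.* F) ≡ + 16 ℤ.* + B ℤ.* + K ℤ.* + F
      cast-rhs = trans (pos-* (16 ℕ.* B ℕ.* K) F)
                   (cong (ℤ._* + F) (trans (pos-* (16 ℕ.* B) K) (cong (ℤ._* + K) (pos-* 16 B))))


open import Defs
open Sums using (Σ-sum; Σperm)
open Summation using (module Totals)
open Rationals using (/-cross; rhs-fraction; fraction-identity)
open import Data.Nat using (ℕ; _≤_; _∸_; zero; suc; _!; pred; s≤s)
import Data.Nat as ℕ
open import Data.Nat.Properties using (_!≢0; *-assoc)
open import Data.Integer as ℤ using (ℤ; +_)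
open import Data.Rational using (_/_; _*_; _+_; _-_)
open import Relation.Binary.PropositionalEquality

-- With n = N + 2 and K = n(n − 1), so that n! = K · N!, the total T over
-- all permutations satisfies 9T = N! (16 (n+1) K − 27 K − 6).
mainTheorem7 : (n : ℕ) → (h : 3 ≤ n) →
    expectedComparisons n
      ≡ ((+ 16 / 9) * (+ (n Data.Nat.+ 1) / 1) - (+ 3 / 1))
          - (+ 2 / 3) * (+ 1 / (n Data.Nat.* (n ∸ 1))) {{nonZero-n[n-1] n h}}
mainTheorem7 (suc (suc zero)) (s≤s (s≤s ()))
mainTheorem7 (suc (suc (suc M))) h =
  begin
    expectedComparisons n
  ≡⟨ cong (λ t → (+ t / n !) {{n !≢0}}) (Σ-sum firstPartitionComparisons (allPerms n)) ⟩
    (+ T / n !) {{n !≢0}}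
  ≡⟨ /-cross (+ T) X (n !) (9 ℕ.* K) {{n !≢0}}
             (trans (fraction-identity T K F (n ℕ.+ 1) (Totals.total-value N))
                    (cong (λ d → X ℤ.* + d) (*-assoc n (suc N) F))) ⟩
    X / (9 ℕ.* K)
  ≡⟨ rhs-fraction (n ℕ.+ 1) (pred K) ⟨
    ((+ 16 / 9) * (+ (n ℕ.+ 1) / 1) - (+ 3 / 1)) - (+ 2 / 3) * (+ 1 / K)
  ∎
  where
    open ≡-Reasoning
    n N F K T : ℕ
    n = suc (suc (suc M))
    N = suc M
    F = N !
    K = n ℕ.* (n ∸ 1)
    T = Σperm firstPartitionComparisons (oneTo n)
    X : ℤ
    X = + 16 ℤ.* + (n ℕ.+ 1) ℤ.* + K ℤ.- + 27 ℤ.* + K ℤ.- + 6
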